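{- For every function $f\in\mathrm{FP}$ there exists a finite, orthogonal, and predicative recursive (constructor) TRS $\mathcal{R}_f$ that computes $f$.
   Context: $\mathrm{FP}$ is the class of polynomial-time computable functions (here on natural numbers in binary notation, represented as values built from a constant $\epsilon$ and unary constructors $\mathsf{S}_1,\mathsf{S}_2$). A TRS computes $f$ if for some defined symbol $g$ the relation $[\![g]\!]$ it defines is $f$, where $(v_1,\dots,v_n,w)\in[\![g]\!]$ iff $g(v_1,\dots,v_n)$ innermost-rewrites to the normal form value $w$. Terms: over a finite signature $\mathcal{F}=\mathcal{D}\uplus\mathcal{C}$ (defined symbols, constructors); values are terms of variables and constructors; basic terms are $h(v_1,\dots,v_n)$ with $h\in\mathcal{D}$, $v_i$ values; a constructor TRS has only basic left-hand sides. Orthogonal: left-linear and non-overlapping. Predicative recursive: a constructor TRS $\mathcal{R}$ with $l>_{\mathsf{pop*}}r$ for all rules, for some safe mapping and admissible precedence, where: a safe mapping assigns to each symbol a set of safe argument positions (all positions safe for constructors), writing $h(s_1,\dots,s_k;s_{k+1},\dots,s_{k+l})$ with the first $k$ normal; a precedence is a preorder $\succsim$ ($\succ$ strict, $\sim$ equivalence), admissible if $\sim$ only relates two defined symbols or two constructors; $s\approx t$ iff $s=t$ or $s=h(\vec s)$, $t=g(\vec t)$, $h\sim g$, with a permutation $\pi$, $s_i\approx t_{\pi(i)}$, preserving normal/safe status; $\mathcal{T}(\mathcal{F}_{<h},\mathcal{V})$ are terms over variables and symbols below $h$. For $s=h(s_1,\dots,s_{k+l})$: $s>_{\mathsf{sq}}t$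 iff $s_i(>_{\mathsf{sq}}\cup\approx)t$ for some $i$ (normal if $h\in\mathcal{D}$), or $h\in\mathcal{D}$, $t=g(t_1..t_p)$, $h\succ g$, $s>_{\mathsf{sq}}t_i$ for all $i$. $s>_{\mathsf{pop*}}t$ iff (1) $s_i\ge_{\mathsf{pop*}}t$ for some $i$; or (2) $h\in\mathcal{D}$, $t=g(t_1..t_m;t_{m+1}..t_{m+n})$, $h\succ g$, $s>_{\mathsf{sq}}t_j$ for normal $j$, $s>_{\mathsf{pop*}}t_j$ for safe $j$, at most one safe $t_j\notin\mathcal{T}(\mathcal{F}_{<h},\mathcal{V})$; or (3) $h\in\mathcal{D}$, $h\sim g$, normal arguments decrease in the strict multiset extension of $>_{\mathsf{pop*}}$ and safe arguments in the weak one (modulo $\approx$); $\ge_{\mathsf{pop*}}={>_{\mathsf{pop*}}}\cup\approx$. -}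

module Defs where

open import Data.Nat using (ℕ; zero; suc; _+_; _*_; _^_; _≤_)
open import Data.Fin using (Fin; zero; suc)
open import Data.Bool using (Bool; true; false; not; if_then_else_)
open import Data.Maybe using (Maybe; just; nothing)
open import Data.Vec as V using (Vec; []; _∷_; lookup; _[_]≔_)
import Data.Vec.Relation.Unary.All as VAll
open import Data.List as L using (List; []; _∷_; _++_; length; concat)
open import Data.List.Relation.Unary.All using (All)
open import Data.List.Relation.Unary.Any using (Any)
open import Data.List.Membership.Propositional using (_∈_)
open import Data.List.Relation.Binary.Pointwise using (Pointwise)
open import Data.List.Relation.Binary.Permutation.Propositional using (_↭_)
open import Data.Product using (Σ; _×_; _,_; proj₁; proj₂)
open import Data.Sum using (_⊎_)
open import Relation.Nullary using (¬_)
open import Relation.Binary.PropositionalEquality using (_≡_; subst; sym)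
open import Relation.Binary.Structures using (IsPreorder)
open import Relation.Binary.Construct.Closure.ReflexiveTransitive using (Star)
open import Function.Bundles using (_↔_; Inverse; _⇔_)

data W : Set where
  ε  : W
  S₁ : W → W
  S₂ : W → W

-- FP: polynomial-time computable functions, via single-tape Turing machines
-- Tape alphabet Fin 4:  0 = blank, 1 = digit 1, 2 = digit 2, 3 = separator

data Move : Set where
  left right stay : Move

record TM : Set where
  field
    Q       : ℕ
    start   : Fin Q
    halting : Fin Q → Bool
    δ       : Fin Q → Fin 4 → Fin Q × Fin 4 × Move

record Config (Q : ℕ) : Set where
  constructor conf
  field
    state : Fin Q
    lft   : List (Fin 4)   -- cells left of the head, nearest first
    hd    : Fin 4
    rgt   : List (Fin 4)   -- cells right of the head, nearest first

blank one two sep : Fin 4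
blank = zero
one   = suc zero
two   = suc (suc zero)
sep   = suc (suc (suc zero))

doMove : ∀ {Q} → Fin Q → List (Fin 4) → Fin 4 → List (Fin 4) → Move → Config Q
doMove q l a r stay = conf q l a r
doMove q [] a r left = conf q [] blank (a ∷ r)
doMove q (b ∷ l) a r left = conf q l b (a ∷ r)
doMove q l a [] right = conf q (a ∷ l) blank []
doMove q l a (b ∷ r) right = conf q (a ∷ l) b r

step : (M : TM) → Config (TM.Q M) → Config (TM.Q M)
step M (conf q l a r) with TM.halting M q
... | true  = conf q l a r
... | false with TM.δ M q a
...   | q' , a' , m = doMove q' l a' r m

run : (M : TM) → ℕ → Config (TM.Q M) → Config (TM.Q M)
run M zero c    = c
run M (suc t) c = run M t (step M c)

wordSyms : W → List (Fin 4)
wordSyms ε      = []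
wordSyms (S₁ w) = one ∷ wordSyms w
wordSyms (S₂ w) = two ∷ wordSyms w

-- input w₁ # w₂ # … # wₙ #
inputSyms : ∀ {n} → Vec W n → List (Fin 4)
inputSyms []       = []
inputSyms (w ∷ ws) = wordSyms w ++ (sep ∷ inputSyms ws)

initConfig : (M : TM) → List (Fin 4) → Config (TM.Q M)
initConfig M []       = conf (TM.start M) [] blank []
initConfig M (a ∷ as) = conf (TM.start M) [] a as

-- output: the maximal word over {1,2} starting at the head
readW : List (Fin 4) → W
readW (suc zero ∷ xs)       = S₁ (readW xs)
readW (suc (suc zero) ∷ xs) = S₂ (readW xs)
readW _                     = ε

output : ∀ {Q} → Config Q → W
output (conf q l a r) = readW (a ∷ r)

inputSize : ∀ {n} → Vec W n → ℕ
inputSize ws = length (inputSyms ws)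

FP : ∀ {n} → (Vec W n → W) → Set
FP f = Σ TM λ M → Σ ℕ λ c → Σ ℕ λ d → ∀ ws →
  Σ ℕ λ t → t ≤ c * (suc (inputSize ws)) ^ d
    × TM.halting M (Config.state (run M t (initConfig M (inputSyms ws)))) ≡ true
    × output (run M t (initConfig M (inputSyms ws))) ≡ f ws

record Signature : Set where
  field
    nsym    : ℕ
    arity   : Fin nsym → ℕ
    defined : Fin nsym → Bool   -- true: defined symbol, false: constructor

data Sym (sig : Signature) : Set where
  ε̂ ŝ₁ ŝ₂ : Sym sig
  sym′     : Fin (Signature.nsym sig) → Sym sig

module Sig (sig : Signature) where

  ar : Sym sig → ℕ
  ar ε̂ = 0
  ar ŝ₁ = 1
  ar ŝ₂ = 1
  ar (sym′ i) = Signature.arity sig i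

  isDef : Sym sig → Bool
  isDef (sym′ i) = Signature.defined sig i
  isDef _ = false

  data Term : Set where
    var : ℕ → Term
    app : (f : Sym sig) → Vec Term (ar f) → Term

  enc : W → Term
  enc ε      = app ε̂ []
  enc (S₁ w) = app ŝ₁ (enc w ∷ [])
  enc (S₂ w) = app ŝ₂ (enc w ∷ [])

  Subst : Set
  Subst = ℕ → Term

  mutual
    sub : Subst → Term → Term
    sub σ (var x)    = σ x
    sub σ (app f ts) = app f (subs σ ts)

    subs : ∀ {n} → Subst → Vec Term n → Vec Term n
    subs σ []       = []
    subs σ (t ∷ ts) = sub σ t ∷ subs σ ts

  data IsValue : Term → Set where
    vvar : ∀ x → IsValue (var x)
    vapp : ∀ {f ts} → isDef f ≡ false → VAll.All IsValue ts → IsValue (app f ts)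

  data IsVar : Term → Set where
    isvar : ∀ x → IsVar (var x)

  data _∈V_ (x : ℕ) : Term → Set where
    here  : x ∈V var x
    there : ∀ {f ts} (i : Fin (ar f)) → x ∈V lookup ts i → x ∈V app f ts

  lookupℕ : ∀ {A : Set} {n} → Vec A n → ℕ → Maybe A
  lookupℕ []       _       = nothing
  lookupℕ (x ∷ xs) zero    = just x
  lookupℕ (x ∷ xs) (suc k) = lookupℕ xs k

  -- positions are lists of argument indices (0-based)
  Pos : Set
  Pos = List ℕ

  mutual
    _at_ : Term → Pos → Maybe Term
    t at []               = just t
    var x at (_ ∷ _)      = nothing
    app f ts at (k ∷ p)   = atArg ts k p

    atArg : ∀ {n} → Vec Term n → ℕ → Pos → Maybe Term
    atArg []       _       p = nothing
    atArg (t ∷ ts) zero    p = t at p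
    atArg (t ∷ ts) (suc k) p = atArg ts k p

  record Rule : Set where
    constructor _⟶_
    field
      lhs : Term
      rhs : Term
  open Rule public

  TRS : Set
  TRS = List Rule

  WellFormed : TRS → Set
  WellFormed R = ∀ {ρ} → ρ ∈ R → ¬ IsVar (lhs ρ) × (∀ x → x ∈V rhs ρ → x ∈V lhs ρ)

  IsBasic : Term → Set
  IsBasic t = Σ (Sym sig) λ f → Σ (Vec Term (ar f)) λ ts →
    t ≡ app f ts × isDef f ≡ true × VAll.All IsValue ts

  ConstructorTRS : TRS → Set
  ConstructorTRS R = ∀ {ρ} → ρ ∈ R → IsBasic (lhs ρ)

  Linear : Term → Set
  Linear t = ∀ p q x → t at p ≡ just (var x) → t at q ≡ just (var x) → p ≡ q

  LeftLinear : TRS → Set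
  LeftLinear R = ∀ {ρ} → ρ ∈ R → Linear (lhs ρ)

  -- no two rules (variables renamed apart, via two independent substitutions)
  -- overlap, except a rule with itself at the root
  NonOverlapping : TRS → Set
  NonOverlapping R = ∀ (i j : Fin (length R)) (p : Pos) (u : Term) (σ τ : Subst) →
    lhs (L.lookup R i) at p ≡ just u → ¬ IsVar u →
    sub σ u ≡ sub τ (lhs (L.lookup R j)) → (i ≡ j × p ≡ [])

  Orthogonal : TRS → Set
  Orthogonal R = LeftLinear R × NonOverlapping R

  data Red (R : TRS) : Term → Set where
    redex  : ∀ {ρ} → ρ ∈ R → (σ : Subst) → Red R (sub σ (lhs ρ))
    inside : ∀ {f ts} (i : Fin (ar f)) → Red R (lookup ts i) → Red R (app f ts)

  NF : TRS → Term → Set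
  NF R t = ¬ Red R t

  data _⊢_⟶ᵢ_ (R : TRS) : Term → Term → Set where
    root : ∀ {ρ} → ρ ∈ R → (σ : Subst) → ∀ {f ts} → sub σ (lhs ρ) ≡ app f ts →
           VAll.All (NF R) ts → R ⊢ sub σ (lhs ρ) ⟶ᵢ sub σ (rhs ρ)
    cong : ∀ {f ts u} (i : Fin (ar f)) → R ⊢ lookup ts i ⟶ᵢ u →
           R ⊢ app f ts ⟶ᵢ app f (ts [ i ]≔ u)

  _⊢_⟶ᵢ*_ : TRS → Term → Term → Set
  R ⊢ s ⟶ᵢ* t = Star (R ⊢_⟶ᵢ_) s t

  ⟦_⟧ : ∀ {n} → TRS → (g : Sym sig) → ar g ≡ n → Vec W n → W → Set
  ⟦_⟧ R g eq vs w = R ⊢ app g (subst (Vec Term) (sym eq) (V.map enc vs)) ⟶ᵢ* enc w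
                    × IsValue (enc w) × NF R (enc w)

  Computes : ∀ {n} → TRS → (Vec W n → W) → Set
  Computes {n} R f = Σ (Sym sig) λ g → isDef g ≡ true × Σ (ar g ≡ n) λ eq →
    ∀ vs w → ⟦_⟧ R g eq vs w ⇔ (f vs ≡ w)

  selectV : ∀ {A : Set} {n} → (Fin n → Bool) → Vec A n → List A
  selectV p []       = []
  selectV p (x ∷ xs) = if p zero then x ∷ selectV (λ i → p (suc i)) xs
                                 else selectV (λ i → p (suc i)) xs

  MulGt : (Term → Term → Set) → (Term → Term → Set) → List Term → List Term → Set
  MulGt R E xs ys = Σ (List Term) λ X → Σ (List Term) λ Y → Σ (List Term) λ X′ → Σ (List Term) λ Z →
    xs ↭ X ++ Y × ys ↭ X′ ++ Z × Pointwise E X X′ × ¬ (Y ≡ [])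
    × All (λ z → Any (λ y → R y z) Y) Z

  MulGe : (Term → Term → Set) → (Term → Term → Set) → List Term → List Term → Set
  MulGe R E xs ys = Σ (List Term) λ X → Σ (List Term) λ Y → Σ (List Term) λ X′ → Σ (List Term) λ Z →
    xs ↭ X ++ Y × ys ↭ X′ ++ Z × Pointwise E X X′
    × All (λ z → Any (λ y → R y z) Y) Z

  SafeMapping : Set
  SafeMapping = (f : Sym sig) → Fin (ar f) → Bool   -- true: safe position

  IsSafeMapping : SafeMapping → Set
  IsSafeMapping safe = ∀ f i → isDef f ≡ false → safe f i ≡ true

  Precedence : Set₁
  Precedence = Sym sig → Sym sig → Set

  module POP (safe : SafeMapping) (_≿_ : Precedence) where

    _≻_ : Sym sig → Sym sig → Set
    f ≻ g = f ≿ g × ¬ (g ≿ f)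

    _∼_ : Sym sig → Sym sig → Set
    f ∼ g = f ≿ g × g ≿ f

    normals : (f : Sym sig) → Vec Term (ar f) → List Term
    normals f ts = selectV (λ i → not (safe f i)) ts

    safes : (f : Sym sig) → Vec Term (ar f) → List Term
    safes f ts = selectV (safe f) ts

    data _≈_ : Term → Term → Set where
      ≈refl : ∀ {s} → s ≈ s
      ≈perm : ∀ {h g ss ts} → h ∼ g → (π : Fin (ar h) ↔ Fin (ar g)) →
              (∀ i → lookup ss i ≈ lookup ts (Inverse.to π i)) →
              (∀ i → safe g (Inverse.to π i) ≡ safe h i) →
              app h ss ≈ app g ts

    data _>sq_ : Term → Term → Set where
      sq-sub  : ∀ {h ss t} (i : Fin (ar h)) → (isDef h ≡ true → safe h i ≡ false) →
                (lookup ss i >sq t ⊎ lookup ss i ≈ t) → app h ss >sq t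
      sq-prec : ∀ {h ss g ts} → isDef h ≡ true → h ≻ g →
                (∀ j → app h ss >sq lookup ts j) → app h ss >sq app g ts

    data Below (h : Sym sig) : Term → Set where
      bvar : ∀ x → Below h (var x)
      bapp : ∀ {g ts} → h ≻ g → (∀ i → Below h (lookup ts i)) → Below h (app g ts)

    data _>pop_ : Term → Term → Set where
      pop-sub  : ∀ {h ss t} (i : Fin (ar h)) →
                 (lookup ss i >pop t ⊎ lookup ss i ≈ t) → app h ss >pop t
      pop-prec : ∀ {h ss g ts} → isDef h ≡ true → h ≻ g →
                 (∀ j → safe g j ≡ false → app h ss >sq lookup ts j) →
                 (∀ j → safe g j ≡ true → app h ss >pop lookup ts j) →
                 (∀ j k → safe g j ≡ true → safe g k ≡ true →
                    ¬ Below h (lookup ts j) → ¬ Below h (lookup ts k) → j ≡ k) →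
                 app h ss >pop app g ts
      pop-eq   : ∀ {h ss g ts} → isDef h ≡ true → h ∼ g →
                 MulGt _>pop_ _≈_ (normals h ss) (normals g ts) →
                 MulGe _>pop_ _≈_ (safes h ss) (safes g ts) →
                 app h ss >pop app g ts

  AdmissiblePrecedence : Precedence → Set
  AdmissiblePrecedence _≿_ = IsPreorder _≡_ _≿_ ×
    (∀ f g → f ≿ g → g ≿ f → isDef f ≡ isDef g)

  PredicativeRecursive : TRS → Set₁
  PredicativeRecursive R = ConstructorTRS R ×
    Σ SafeMapping λ safe → Σ Precedence λ prec →
      IsSafeMapping safe × AdmissiblePrecedence prec ×
      (∀ {ρ} → ρ ∈ R → POP._>pop_ safe prec (lhs ρ) (rhs ρ))

module Submission where

-- Let M compute f within c·(s+1)^d steps on inputs of size s.  We build a TRS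
-- that simulates M: a configuration is the constructor term cf(q, l, a, r), a
-- ground term lists the transition function, the symbol step performs one
-- move, and symbols it_D, …, it_0 nest D = c+d loops over the input list of
-- length L = s+2, so that g(v⃗) performs L^D ≥ c·(s+1)^d steps and then reads
-- off the output.  As halted configurations are fixed points, this yields the
-- output of M.

open import Defs
open import Data.Nat using (ℕ; zero; suc; _+_; _*_; _^_; _≤_; _<_; z≤n; s≤s; _≤ᵇ_; _≡ᵇ_; _<ᵇ_; _<?_; _∸_)
open import Data.Nat.Properties
open import Data.Fin using (Fin; zero; suc; toℕ; fromℕ<; #_)
import Data.Fin.Properties as FinP
open import Data.Bool using (Bool; true; false; not; if_then_else_; _∧_; _∨_; T)
open import Data.Bool.Properties using (T-∧; T-∨; T-≡; T-not-≡; ¬-not)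
open import Data.Maybe.Properties using (just-injective)
open import Data.List.Properties using (∷-injective)
open import Data.Maybe using (Maybe; just; nothing)
open import Data.Vec as V using (Vec; []; _∷_; lookup; _[_]≔_)
import Data.Vec.Properties as VecP
import Data.Vec.Relation.Unary.All as VAll
open import Data.Vec.Relation.Unary.All.Properties using (lookup⁺)
open import Data.List as L using (List; []; _∷_; _++_; length)
open import Data.List.Relation.Unary.All as LAll using (All; []; _∷_)
import Data.List.Relation.Unary.All.Properties as LAllP
open import Data.List.Relation.Unary.Any using (here; there)
open import Data.List.Relation.Unary.AllPairs as AllPairs using (AllPairs; []; _∷_)
import Data.List.Relation.Unary.AllPairs.Properties as AllPairsP
open import Data.List.Membership.Propositional using (_∈_)
open import Data.List.Membership.Propositional.Properties using (∈-++⁺ˡ; ∈-++⁺ʳ; ∈-lookup)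
import Data.List.Relation.Binary.Permutation.Propositional as Perm
import Data.List.Relation.Binary.Pointwise as Pointwise
open import Data.Product using (Σ; _×_; _,_; proj₁; proj₂)
open import Data.Sum using (_⊎_; inj₁; inj₂)
open import Data.Empty using (⊥-elim)
open import Data.Unit using (tt)
open import Function using (_∘_; Equivalence; mk⇔)
open import Relation.Nullary using (¬_; yes; no)
open import Relation.Nullary.Decidable using (toWitness; T?)
open import Relation.Binary.PropositionalEquality
open import Relation.Binary.Construct.Closure.ReflexiveTransitive as Star using (_◅_; _◅◅_)

-- The scheme c·(s+1)^d ≤ (s+2)^(c+d) lets D = c+d nested loops over a list
-- of length s+2 outlast any machine with time bound c·(s+1)^d.

n<m^n : ∀ m n → 1 < m → n < m ^ n
n<m^n m zero    1<m = s≤s z≤n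
n<m^n m (suc n) 1<m = ≤-<-trans (n<m^n m n 1<m) (^-monoʳ-< m 1<m (n<1+n n))

polynomial≤power : ∀ c d s → c * suc s ^ d ≤ (2 + s) ^ (c + d)
polynomial≤power c d s = begin
  c * suc s ^ d            ≤⟨ *-mono-≤ (<⇒≤ (n<m^n (2 + s) c (s≤s (s≤s z≤n))))
                                        (^-monoˡ-≤ d (n≤1+n (suc s))) ⟩
  (2 + s) ^ c * (2 + s) ^ d ≡⟨ ^-distribˡ-+-* (2 + s) c d ⟨
  (2 + s) ^ (c + d)        ∎
  where open ≤-Reasoning

module Runs (M : TM) where

  run-+ : ∀ a b c → run M (a + b) c ≡ run M b (run M a c)
  run-+ zero    b c = refl
  run-+ (suc a) b c = run-+ a b (step M c)

  Halted : Config (TM.Q M) → Set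
  Halted c = TM.halting M (Config.state c) ≡ true

  step-halted : ∀ c → Halted c → step M c ≡ c
  step-halted (conf q l a r) h with TM.halting M q
  step-halted (conf q l a r) refl | .true = refl

  run-halted : ∀ k c → Halted c → run M k c ≡ c
  run-halted zero    c h = refl
  run-halted (suc k) c h rewrite step-halted c h = run-halted k c h

  run-beyond-halting : ∀ t N c → t ≤ N → Halted (run M t c) → run M N c ≡ run M t c
  run-beyond-halting t N c t≤N h = begin
    run M N c                   ≡⟨ cong (λ k → run M k c) (m+[n∸m]≡n t≤N) ⟨
    run M (t + (N ∸ t)) c       ≡⟨ run-+ t (N ∸ t) c ⟩
    run M (N ∸ t) (run M t c)   ≡⟨ run-halted (N ∸ t) (run M t c) h ⟩
    run M t c                   ∎
    where open ≡-Reasoning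

module Rewriting (sig : Signature) where
  open Sig sig renaming (cong to ⟶ᵢ-cong)

  data Ground : Term → Set where
    ground : ∀ {f ts} → isDef f ≡ false → VAll.All Ground ts → Ground (app f ts)

  mutual
    ground-value : ∀ {t} → Ground t → IsValue t
    ground-value (ground d gs) = vapp d (grounds-values gs)

    grounds-values : ∀ {k} {ts : Vec Term k} → VAll.All Ground ts → VAll.All IsValue ts
    grounds-values VAll.[]       = VAll.[]
    grounds-values (g VAll.∷ gs) = ground-value g VAll.∷ grounds-values gs

  ground-no-var : ∀ {t x} → Ground t → ¬ (x ∈V t)
  ground-no-var (ground _ gs) (there i p) = ground-no-var (lookup⁺ gs i) p

  mutual
    sub-ground : ∀ σ {t} → Ground t → sub σ t ≡ t
    sub-ground σ (ground {f} _ gs) = cong (app f) (subs-ground σ gs)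

    subs-ground : ∀ σ {k} {ts : Vec Term k} → VAll.All Ground ts → subs σ ts ≡ ts
    subs-ground σ VAll.[]       = refl
    subs-ground σ (g VAll.∷ gs) = cong₂ _∷_ (sub-ground σ g) (subs-ground σ gs)

  enc-ground : ∀ w → Ground (enc w)
  enc-ground ε      = ground refl VAll.[]
  enc-ground (S₁ w) = ground refl (enc-ground w VAll.∷ VAll.[])
  enc-ground (S₂ w) = ground refl (enc-ground w VAll.∷ VAll.[])

  encs-ground : ∀ {k} (ws : Vec W k) → VAll.All Ground (V.map enc ws)
  encs-ground []       = VAll.[]
  encs-ground (w ∷ ws) = enc-ground w VAll.∷ encs-ground ws

  argument : Term → Term
  argument (app ŝ₁ (t ∷ [])) = t
  argument (app ŝ₂ (t ∷ [])) = t
  argument t                 = t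

  enc-injective : ∀ {w w′} → enc w ≡ enc w′ → w ≡ w′
  enc-injective {ε}    {ε}     _ = refl
  enc-injective {S₁ w} {S₁ w′} e = cong S₁ (enc-injective (cong argument e))
  enc-injective {S₂ w} {S₂ w′} e = cong S₂ (enc-injective (cong argument e))
  enc-injective {ε}    {S₁ _}  ()
  enc-injective {ε}    {S₂ _}  ()
  enc-injective {S₁ _} {ε}     ()
  enc-injective {S₁ _} {S₂ _}  ()
  enc-injective {S₂ _} {ε}     ()
  enc-injective {S₂ _} {S₁ _}  ()

  head-symbol : Term → Maybe (Sym sig)
  head-symbol (var _)   = nothing
  head-symbol (app f _) = just f

  module Reduction (R : TRS) where

    -- Values contain no defined symbol, while every lhs of a constructor TRS
    -- is rooted by one; hence values are normal forms.
    value-normal : ConstructorTRS R → ∀ {t} → IsValue t → NF R t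
    value-normal basic v (redex {ρ} ρ∈R σ) with basic ρ∈R
    ... | f , ts , l≡fts , d , _ = defined-not-value (subst (λ l → IsValue (sub σ l)) l≡fts v)
      where
        defined-not-value : ¬ IsValue (app f (subs σ ts))
        defined-not-value (vapp d′ _) with trans (sym d) d′
        ... | ()
    value-normal basic (vapp _ vs) (inside i r) = value-normal basic (lookup⁺ vs i) r

    reduce-arg : ∀ {f} {ts : Vec Term (ar f)} (i : Fin (ar f)) {u} →
                 R ⊢ lookup ts i ⟶ᵢ* u → R ⊢ app f ts ⟶ᵢ* app f (ts [ i ]≔ u)
    reduce-arg {f} {ts} i = go ts refl
      where
        go : ∀ us {t u} → lookup us i ≡ t → R ⊢ t ⟶ᵢ* u → R ⊢ app f us ⟶ᵢ* app f (us [ i ]≔ u)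
        go us refl Star.ε =
          subst (λ vs → R ⊢ app f us ⟶ᵢ* app f vs) (sym (VecP.[]≔-lookup us i)) Star.ε
        go us refl (s ◅ ss) =
          ⟶ᵢ-cong i s ◅ subst (λ vs → R ⊢ app f (us [ i ]≔ _) ⟶ᵢ* app f vs)
                              (VecP.[]≔-idempotent us i)
                              (go (us [ i ]≔ _) (VecP.lookup∘update i us _) ss)

  -- If every rule
  -- is an identity under it, rewriting preserves the interpretation; if it is
  -- the identity on constructors, ground constructor terms denote themselves.
  module Interpretation (I : (f : Sym sig) → Vec Term (ar f) → Term) where

    mutual
      ev : (ℕ → Term) → Term → Term
      ev env (var x)    = env x
      ev env (app f ts) = I f (evs env ts)

      evs : ∀ {k} → (ℕ → Term) → Vec Term k → Vec Term k
      evs env []       = []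
      evs env (t ∷ ts) = ev env t ∷ evs env ts

    mutual
      ev-sub : ∀ env σ t → ev env (sub σ t) ≡ ev (ev env ∘ σ) t
      ev-sub env σ (var x)    = refl
      ev-sub env σ (app f ts) = cong (I f) (evs-sub env σ ts)

      evs-sub : ∀ env σ {k} (ts : Vec Term k) → evs env (subs σ ts) ≡ evs (ev env ∘ σ) ts
      evs-sub env σ []       = refl
      evs-sub env σ (t ∷ ts) = cong₂ _∷_ (ev-sub env σ t) (evs-sub env σ ts)

    module _ (I-con : ∀ f us → isDef f ≡ false → I f us ≡ app f us) where
      mutual
        ev-ground : ∀ env {t} → Ground t → ev env t ≡ t
        ev-ground env (ground {f} {ts} d gs) = trans (cong (I f) (evs-ground env gs)) (I-con f ts d)

        evs-ground : ∀ env {k} {ts : Vec Term k} → VAll.All Ground ts → evs env ts ≡ ts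
        evs-ground env VAll.[]       = refl
        evs-ground env (g VAll.∷ gs) = cong₂ _∷_ (ev-ground env g) (evs-ground env gs)

    Sound : Rule → Set
    Sound ρ = ∀ env → ev env (lhs ρ) ≡ ev env (rhs ρ)

    module _ {R : TRS} (sound : All Sound R) where

      ev-update : ∀ {k} (ts : Vec Term k) i u → ev var (lookup ts i) ≡ ev var u →
                  evs var (ts [ i ]≔ u) ≡ evs var ts
      ev-update (t ∷ ts) zero    u e = cong (_∷ evs var ts) (sym e)
      ev-update (t ∷ ts) (suc i) u e = cong (ev var t ∷_) (ev-update ts i u e)

      ev-step : ∀ {s t} → R ⊢ s ⟶ᵢ t → ev var s ≡ ev var t
      ev-step (root {ρ} ρ∈R σ _ _) = begin
        ev var (sub σ (lhs ρ))      ≡⟨ ev-sub var σ (lhs ρ) ⟩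
        ev (ev var ∘ σ) (lhs ρ)     ≡⟨ LAll.lookup sound ρ∈R (ev var ∘ σ) ⟩
        ev (ev var ∘ σ) (rhs ρ)     ≡⟨ ev-sub var σ (rhs ρ) ⟨
        ev var (sub σ (rhs ρ))      ∎
        where open ≡-Reasoning
      ev-step (⟶ᵢ-cong {f} {ts} {u} i s) = cong (I f) (sym (ev-update ts i u (ev-step s)))

      ev-steps : ∀ {s t} → R ⊢ s ⟶ᵢ* t → ev var s ≡ ev var t
      ev-steps Star.ε   = refl
      ev-steps (s ◅ ss) = trans (ev-step s) (ev-steps ss)

  -- Boolean criteria for the syntactic conditions on rules; for concrete
  -- rules they are discharged by evaluation.
  T-∧⁻ : ∀ {a b} → T (a ∧ b) → T a × T b
  T-∧⁻ {a} {b} = Equivalence.to (T-∧ {a} {b})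

  T-∨⁻ : ∀ {a b} → T (a ∨ b) → T a ⊎ T b
  T-∨⁻ {a} {b} = Equivalence.to (T-∨ {a} {b})

  mutual
    isValue? : Term → Bool
    isValue? (var _)    = true
    isValue? (app f ts) = not (isDef f) ∧ areValues? ts

    areValues? : ∀ {k} → Vec Term k → Bool
    areValues? []       = true
    areValues? (t ∷ ts) = isValue? t ∧ areValues? ts

  mutual
    value-criterion : ∀ t → T (isValue? t) → IsValue t
    value-criterion (var x)    _ = vvar x
    value-criterion (app f ts) p =
      let c , vs = T-∧⁻ {not (isDef f)} p
      in vapp (Equivalence.to T-not-≡ c) (values-criterion ts vs)

    values-criterion : ∀ {k} (ts : Vec Term k) → T (areValues? ts) → VAll.All IsValue ts
    values-criterion []       _ = VAll.[]
    values-criterion (t ∷ ts) p =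
      let v , vs = T-∧⁻ {isValue? t} p
      in value-criterion t v VAll.∷ values-criterion ts vs

  isBasic? : Term → Bool
  isBasic? (var _)    = false
  isBasic? (app f ts) = isDef f ∧ areValues? ts

  basic-criterion : ∀ t → T (isBasic? t) → IsBasic t
  basic-criterion (app f ts) p =
    let d , vs = T-∧⁻ {isDef f} p
    in f , ts , refl , Equivalence.to T-≡ d , values-criterion ts vs

  -- Linearity and the variable condition are decided by counting
  -- occurrences of the variables below a bound.
  mutual
    occurrences : Term → ℕ → ℕ
    occurrences (var y)    x = if y ≡ᵇ x then 1 else 0
    occurrences (app f ts) x = occurrencesᵛ ts x

    occurrencesᵛ : ∀ {k} → Vec Term k → ℕ → ℕ
    occurrencesᵛ []       x = 0
    occurrencesᵛ (t ∷ ts) x = occurrences t x + occurrencesᵛ ts x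

  occurrences-lookup : ∀ {k} (ts : Vec Term k) i x → occurrences (lookup ts i) x ≤ occurrencesᵛ ts x
  occurrences-lookup (t ∷ ts) zero    x = m≤m+n _ _
  occurrences-lookup (t ∷ ts) (suc i) x = ≤-trans (occurrences-lookup ts i x) (m≤n+m _ _)

  occurs⇒positive : ∀ {x t} → x ∈V t → 1 ≤ occurrences t x
  occurs⇒positive {x} here rewrite Equivalence.to T-≡ (≡⇒≡ᵇ x x refl) = ≤-refl
  occurs⇒positive {x} (there {ts = ts} i p) = ≤-trans (occurs⇒positive p) (occurrences-lookup ts i x)

  mutual
    positive⇒occurs : ∀ t x → 1 ≤ occurrences t x → x ∈V t
    positive⇒occurs (var y) x c with y ≡ᵇ x in eq
    ... | true rewrite ≡ᵇ⇒≡ y x (Equivalence.from T-≡ eq) = here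
    positive⇒occurs (app f ts) x c =
      let i , p = positive⇒occursᵛ ts x c in there i p

    positive⇒occursᵛ : ∀ {k} (ts : Vec Term k) x → 1 ≤ occurrencesᵛ ts x →
                       Σ (Fin k) λ i → x ∈V lookup ts i
    positive⇒occursᵛ (t ∷ ts) x c with occurrences t x in eq
    ... | suc _ = zero , positive⇒occurs t x (subst (1 ≤_) (sym eq) (s≤s z≤n))
    ... | zero  = let i , p = positive⇒occursᵛ ts x c in suc i , p

  mutual
    at-var⇒occurs : ∀ t p x → t at p ≡ just (var x) → x ∈V t
    at-var⇒occurs (var y)    []      x refl = here
    at-var⇒occurs (app f ts) (k ∷ p) x e    = let i , o = atArg-var⇒occurs ts k p x e in there i o

    atArg-var⇒occurs : ∀ {m} (ts : Vec Term m) k p x → atArg ts k p ≡ just (var x) →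
                       Σ (Fin m) λ i → x ∈V lookup ts i
    atArg-var⇒occurs (t ∷ ts) zero    p x e = zero , at-var⇒occurs t p x e
    atArg-var⇒occurs (t ∷ ts) (suc k) p x e = let i , o = atArg-var⇒occurs ts k p x e in suc i , o

  occurs-twice : ∀ {x t k} {ts : Vec Term k} i → x ∈V t → x ∈V lookup ts i →
                 ¬ (occurrences t x + occurrencesᵛ ts x ≤ 1)
  occurs-twice {ts = ts} i o o′ c
    with ≤-trans (+-mono-≤ (occurs⇒positive o) (≤-trans (occurs⇒positive o′) (occurrences-lookup ts i _))) c
  ... | s≤s ()

  mutual
    single-position : ∀ t p q x → occurrences t x ≤ 1 →
                      t at p ≡ just (var x) → t at q ≡ just (var x) → p ≡ q
    single-position (var y)    []      []       x c e e′ = refl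
    single-position (app f ts) (k ∷ p) (k′ ∷ q) x c e e′ = single-positionᵛ ts k p k′ q x c e e′

    single-positionᵛ : ∀ {m} (ts : Vec Term m) k p k′ q x → occurrencesᵛ ts x ≤ 1 →
                       atArg ts k p ≡ just (var x) → atArg ts k′ q ≡ just (var x) → k ∷ p ≡ k′ ∷ q
    single-positionᵛ (t ∷ ts) zero p zero q x c e e′ =
      cong (zero ∷_) (single-position t p q x (≤-trans (m≤m+n _ _) c) e e′)
    single-positionᵛ (t ∷ ts) zero p (suc k′) q x c e e′ =
      let i , o = atArg-var⇒occurs ts k′ q x e′ in ⊥-elim (occurs-twice {ts = ts} i (at-var⇒occurs t p x e) o c)
    single-positionᵛ (t ∷ ts) (suc k) p zero q x c e e′ =
      let i , o = atArg-var⇒occurs ts k p x e in ⊥-elim (occurs-twice {ts = ts} i (at-var⇒occurs t q x e′) o c)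
    single-positionᵛ (t ∷ ts) (suc k) p (suc k′) q x c e e′
      with single-positionᵛ ts k p k′ q x (≤-trans (m≤n+m _ _) c) e e′
    ... | refl = refl

  mutual
    varsBelow : ℕ → Term → Bool
    varsBelow b (var y)    = y <ᵇ b
    varsBelow b (app f ts) = varsBelowᵛ b ts

    varsBelowᵛ : ∀ {k} → ℕ → Vec Term k → Bool
    varsBelowᵛ b []       = true
    varsBelowᵛ b (t ∷ ts) = varsBelow b t ∧ varsBelowᵛ b ts

  mutual
    no-occurrences-above : ∀ b t x → T (varsBelow b t) → b ≤ x → occurrences t x ≡ 0
    no-occurrences-above b (var y) x y<b b≤x with y ≡ᵇ x in eq
    ... | false = refl
    ... | true rewrite ≡ᵇ⇒≡ y x (Equivalence.from T-≡ eq) = ⊥-elim (<⇒≱ (<ᵇ⇒< x b y<b) b≤x)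
    no-occurrences-above b (app f ts) x p b≤x = no-occurrences-aboveᵛ b ts x p b≤x

    no-occurrences-aboveᵛ : ∀ b {k} (ts : Vec Term k) x → T (varsBelowᵛ b ts) → b ≤ x → occurrencesᵛ ts x ≡ 0
    no-occurrences-aboveᵛ b []       x p b≤x = refl
    no-occurrences-aboveᵛ b (t ∷ ts) x p b≤x =
      let q , qs = T-∧⁻ {varsBelow b t} p
      in cong₂ _+_ (no-occurrences-above b t x q b≤x) (no-occurrences-aboveᵛ b ts x qs b≤x)

  allBelow : ℕ → (ℕ → Bool) → Bool
  allBelow zero    p = true
  allBelow (suc m) p = p m ∧ allBelow m p

  allBelow-sound : ∀ m p x → T (allBelow m p) → x < m → T (p x)
  allBelow-sound (suc m) p x q x<1+m with x ≟ m | T-∧⁻ {p m} q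
  ... | yes refl | pm , _  = pm
  ... | no x≢m   | _  , ps = allBelow-sound m p x ps (≤∧≢⇒< (≤-pred x<1+m) x≢m)

  linear? : ℕ → Term → Bool
  linear? b t = varsBelow b t ∧ allBelow b (λ x → occurrences t x ≤ᵇ 1)

  linear-criterion : ∀ b t → T (linear? b t) → Linear t
  linear-criterion b t p q₁ q₂ x = single-position t q₁ q₂ x at-most-once
    where
      at-most-once : occurrences t x ≤ 1
      at-most-once with T-∧⁻ {varsBelow b t} p | x <? b
      ... | _ , counts | yes x<b = ≤ᵇ⇒≤ _ 1 (allBelow-sound b _ x counts x<b)
      ... | below , _  | no x≮b  = subst (_≤ 1) (sym (no-occurrences-above b t x below (≮⇒≥ x≮b))) z≤n

  variableCondition? : ℕ → Term → Term → Bool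
  variableCondition? b l r =
    varsBelow b r ∧ allBelow b (λ x → (occurrences r x ≡ᵇ 0) ∨ (1 ≤ᵇ occurrences l x))

  variable-criterion : ∀ b l r → T (variableCondition? b l r) → ∀ x → x ∈V r → x ∈V l
  variable-criterion b l r p x o with T-∧⁻ {varsBelow b r} p | x <? b
  ... | below , _ | no x≮b =
    ⊥-elim (1+n≰n (subst (1 ≤_) (no-occurrences-above b r x below (≮⇒≥ x≮b)) (occurs⇒positive o)))
  ... | _ , cond | yes x<b with T-∨⁻ {occurrences r x ≡ᵇ 0} (allBelow-sound b _ x cond x<b)
  ...   | inj₂ occurs-in-l = positive⇒occurs l x (≤ᵇ⇒≤ 1 _ occurs-in-l)
  ...   | inj₁ none-in-r =
    ⊥-elim (1+n≰n (subst (1 ≤_) (≡ᵇ⇒≡ (occurrences r x) 0 none-in-r) (occurs⇒positive o)))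

  basic-not-var : ∀ {t} → IsBasic t → ¬ IsVar t
  basic-not-var (f , ts , refl , _) ()

  -- Non-overlap: two terms clash if they have different function symbols at
  -- a common position; clashing terms have no common instance.  First, a
  -- Boolean equality of symbols.
  _==ˢ_ : Sym sig → Sym sig → Bool
  ε̂      ==ˢ ε̂      = true
  ŝ₁     ==ˢ ŝ₁     = true
  ŝ₂     ==ˢ ŝ₂     = true
  sym′ i ==ˢ sym′ j = toℕ i ≡ᵇ toℕ j
  _      ==ˢ _      = false

  ==ˢ-refl : ∀ f → T (f ==ˢ f)
  ==ˢ-refl ε̂        = tt
  ==ˢ-refl ŝ₁       = tt
  ==ˢ-refl ŝ₂       = tt
  ==ˢ-refl (sym′ i) = ≡⇒≡ᵇ (toℕ i) (toℕ i) refl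

  mutual
    clash : Term → Term → Bool
    clash (var _)    _          = false
    clash (app f ts) (var _)    = false
    clash (app f ts) (app g us) = if f ==ˢ g then clashᵛ ts us else true

    clashᵛ : ∀ {a b} → Vec Term a → Vec Term b → Bool
    clashᵛ (t ∷ ts) (u ∷ us) = clash t u ∨ clashᵛ ts us
    clashᵛ _        _        = false

  toList-subs : ∀ σ {k} (ts : Vec Term k) → V.toList (subs σ ts) ≡ L.map (sub σ) (V.toList ts)
  toList-subs σ []       = refl
  toList-subs σ (t ∷ ts) = cong (sub σ t ∷_) (toList-subs σ ts)

  arguments : Term → List Term
  arguments (var _)    = []
  arguments (app f ts) = V.toList ts

  mutual
    clash-sound : ∀ s t σ τ → T (clash s t) → sub σ s ≢ sub τ t
    clash-sound (app f ts) (app g us) σ τ c e with f ==ˢ g in eq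
    ... | true = clashᵛ-sound ts us σ τ c
                   (trans (sym (toList-subs σ ts)) (trans (cong arguments e) (toList-subs τ us)))
    ... | false with just-injective (cong head-symbol e)
    ...   | refl = subst T eq (==ˢ-refl f)

    clashᵛ-sound : ∀ {a b} (ts : Vec Term a) (us : Vec Term b) σ τ → T (clashᵛ ts us) →
                   L.map (sub σ) (V.toList ts) ≢ L.map (sub τ) (V.toList us)
    clashᵛ-sound (t ∷ ts) (u ∷ us) σ τ c e with T-∨⁻ {clash t u} c
    ... | inj₁ c₁ = clash-sound t u σ τ c₁ (proj₁ (∷-injective e))
    ... | inj₂ c₂ = clashᵛ-sound ts us σ τ c₂ (proj₂ (∷-injective e))

  clash-roots : ∀ {f g} (ts : Vec Term (ar f)) (us : Vec Term (ar g)) →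
                T (not (f ==ˢ g)) → T (clash (app f ts) (app g us))
  clash-roots {f} {g} ts us different with f ==ˢ g
  ... | false = tt

  clash-arguments : ∀ {f} (ts us : Vec Term (ar f)) → T (clashᵛ ts us) → T (clash (app f ts) (app f us))
  clash-arguments {f} ts us c with f ==ˢ f | ==ˢ-refl f
  ... | true | _ = c

  Clash : Rule → Rule → Set
  Clash ρ ρ′ = T (clash (lhs ρ) (lhs ρ′))

  root-overlap : ∀ {rs} → AllPairs Clash rs → ∀ i j σ τ →
                 sub σ (lhs (L.lookup rs i)) ≡ sub τ (lhs (L.lookup rs j)) → i ≡ j
  root-overlap (c ∷ cs) zero    zero    σ τ e = refl
  root-overlap {ρ ∷ rs} (c ∷ cs) zero (suc j) σ τ e =
    ⊥-elim (clash-sound (lhs ρ) (lhs (L.lookup rs j)) σ τ (LAll.lookup c (∈-lookup j)) e)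
  root-overlap {ρ ∷ rs} (c ∷ cs) (suc i) zero σ τ e =
    ⊥-elim (clash-sound (lhs ρ) (lhs (L.lookup rs i)) τ σ (LAll.lookup c (∈-lookup i)) (sym e))
  root-overlap (c ∷ cs) (suc i) (suc j) σ τ e = cong suc (root-overlap cs i j σ τ e)

  mutual
    subterm-value : ∀ t p {u} → IsValue t → t at p ≡ just u → IsValue u
    subterm-value t          []      v          refl = v
    subterm-value (app f ts) (k ∷ p) (vapp _ vs) e   = subterm-valueᵛ ts k p vs e

    subterm-valueᵛ : ∀ {m} (ts : Vec Term m) k p {u} → VAll.All IsValue ts → atArg ts k p ≡ just u → IsValue u
    subterm-valueᵛ (t ∷ ts) zero    p (v VAll.∷ vs) e = subterm-value t p v e
    subterm-valueᵛ (t ∷ ts) (suc k) p (v VAll.∷ vs) e = subterm-valueᵛ ts k p vs e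

  -- An instance of a non-variable value is rooted by a constructor, an
  -- instance of a basic term by a defined symbol.
  value-basic-apart : ∀ {u t} σ τ → IsValue u → ¬ IsVar u → IsBasic t → sub σ u ≢ sub τ t
  value-basic-apart σ τ (vvar x)   not-var _                   e = not-var (isvar x)
  value-basic-apart σ τ (vapp d _) _ (g , ts , refl , d′ , _) e with just-injective (cong head-symbol e)
  ... | refl with trans (sym d) d′
  ...   | ()

  -- A constructor TRS with pairwise clashing left-hand sides is non-overlapping:
  -- below the root a lhs consists of values, which cannot match a basic term.
  non-overlapping : ∀ {R} → ConstructorTRS R → AllPairs Clash R → NonOverlapping R
  non-overlapping {R} basic clashes i j []      u σ τ at-u _       e with just-injective at-u
  ... | refl = root-overlap clashes i j σ τ e , refl
  non-overlapping {R} basic clashes i j (k ∷ p) u σ τ at-u not-var e with basic (∈-lookup {xs = R} i)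
  ... | f , ts , l≡fts , _ , values rewrite l≡fts =
    ⊥-elim (value-basic-apart σ τ (subterm-valueᵛ ts k p values at-u) not-var (basic (∈-lookup j)) e)

  module _ {_>_ _≈_ : Term → Term → Set} where

    mulGt-single : ∀ {a b} → a > b → MulGt _>_ _≈_ (a ∷ []) (b ∷ [])
    mulGt-single {a} {b} a>b = [] , a ∷ [] , [] , b ∷ [] , Perm.refl , Perm.refl , Pointwise.[] , (λ ()) , (here a>b ∷ [])

    mulGe-[] : MulGe _>_ _≈_ [] []
    mulGe-[] = [] , [] , [] , [] , Perm.refl , Perm.refl , Pointwise.[] , []

    mulGe-equal : ∀ {a b} → a ≈ b → MulGe _>_ _≈_ (a ∷ []) (b ∷ [])
    mulGe-equal {a} {b} a≈b = a ∷ [] , [] , b ∷ [] , [] , Perm.refl , Perm.refl , (a≈b Pointwise.∷ Pointwise.[]) , []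

    mulGe-single : ∀ {a b} → a > b → MulGe _>_ _≈_ (a ∷ []) (b ∷ [])
    mulGe-single {a} {b} a>b = [] , a ∷ [] , [] , b ∷ [] , Perm.refl , Perm.refl , Pointwise.[] , (here a>b ∷ [])

  positive : ℕ → Bool
  positive zero    = false
  positive (suc _) = true

  -- Values and ground terms lie below
  -- every defined symbol, which settles most rule orientations.
  module RankPrecedence (safe : SafeMapping) (safe-con : IsSafeMapping safe)
                        (rank : Sym sig → ℕ) (def-rank : ∀ f → isDef f ≡ positive (rank f)) where

    _≿_ : Precedence
    f ≿ g = rank g ≤ rank f

    admissible : AdmissiblePrecedence _≿_
    admissible =
      record { isEquivalence = isEquivalence ; reflexive = λ { refl → ≤-refl } ; trans = λ f≿g g≿h → ≤-trans g≿h f≿g } ,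
      λ f g f≿g g≿f → trans (def-rank f) (trans (cong positive (≤-antisym g≿f f≿g)) (sym (def-rank g)))

    open POP safe _≿_ public

    prec< : ∀ {f g} → rank g < rank f → f ≻ g
    prec< g<f = <⇒≤ g<f , <⇒≱ g<f

    ∼-refl : ∀ {f} → f ∼ f
    ∼-refl = ≤-refl , ≤-refl

    ranked⇒defined : ∀ {h} → 1 ≤ rank h → isDef h ≡ true
    ranked⇒defined {h} r with rank h | def-rank h
    ... | suc _ | d = d

    con<ranked : ∀ {c h} → isDef c ≡ false → 1 ≤ rank h → rank c < rank h
    con<ranked {c} d r with rank c | def-rank c
    ... | zero | _ = r
    ... | suc _ | d′ with trans (sym d) d′
    ...   | ()

    mutual
      value-below : ∀ {h t} → 1 ≤ rank h → IsValue t → Below h t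
      value-below r (vvar x)            = bvar x
      value-below r (vapp {c} d vs) = bapp (prec< (con<ranked {c} d r)) (values-below r vs)

      values-below : ∀ {h k} {ts : Vec Term k} → 1 ≤ rank h → VAll.All IsValue ts → ∀ i → Below h (lookup ts i)
      values-below r (v VAll.∷ vs) zero    = value-below r v
      values-below r (v VAll.∷ vs) (suc i) = values-below r vs i

    var-occurrence : ∀ {t x} → x ∈V t → t ≡ var x ⊎ t >pop var x
    var-occurrence here = inj₁ refl
    var-occurrence (there {ts = ts} i o) with var-occurrence o
    ... | inj₁ t≡x = inj₂ (pop-sub i (inj₂ (subst (lookup ts i ≈_) t≡x ≈refl)))
    ... | inj₂ t>x = inj₂ (pop-sub i (inj₁ t>x))

    var-pop : ∀ {h ss x} → x ∈V app h ss → app h ss >pop var x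
    var-pop o with var-occurrence o
    ... | inj₂ t>x = t>x

    mutual
      value-pop : ∀ {h ss t} → 1 ≤ rank h → IsValue t →
                  (∀ x → x ∈V t → x ∈V app h ss) → app h ss >pop t
      value-pop r (vvar x)        inc = var-pop (inc x here)
      value-pop r (vapp {c} d vs) inc = prec-values-pop (con<ranked {c} d r) (λ j → safe-con c j d) vs inc

      prec-values-pop : ∀ {h ss g ts} → rank g < rank h → (∀ j → safe g j ≡ true) →
                        VAll.All IsValue ts → (∀ x → x ∈V app g ts → x ∈V app h ss) → app h ss >pop app g ts
      prec-values-pop {g = g} g<h all-safe vs inc =
        pop-prec (ranked⇒defined h-ranked) (prec< g<h)
          (λ j normal → ⊥-elim (true≢false (trans (sym (all-safe j)) normal)))
          (λ j _ → values-pop h-ranked vs j (λ x o → inc x (there j o)))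
          (λ j _ _ _ not-below _ → ⊥-elim (not-below (values-below h-ranked vs j)))
        where
          h-ranked = ≤-trans (s≤s z≤n) g<h
          true≢false : true ≢ false
          true≢false ()

      values-pop : ∀ {h ss k} {ts : Vec Term k} → 1 ≤ rank h → VAll.All IsValue ts →
                   ∀ j → (∀ x → x ∈V lookup ts j → x ∈V app h ss) → app h ss >pop lookup ts j
      values-pop r (v VAll.∷ vs) zero    inc = value-pop r v inc
      values-pop r (v VAll.∷ vs) (suc j) inc = values-pop r vs j inc

    ground-pop : ∀ {h ss t} → 1 ≤ rank h → Ground t → app h ss >pop t
    ground-pop r g = value-pop r (ground-value g) (λ x o → ⊥-elim (ground-no-var g o))

    mutual
      ground-sq : ∀ {h ss t} → 1 ≤ rank h → Ground t → app h ss >sq t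
      ground-sq r (ground {c} d gs) = sq-prec (ranked⇒defined r) (prec< (con<ranked {c} d r)) (grounds-sq r gs)

      grounds-sq : ∀ {h ss k} {ts : Vec Term k} → 1 ≤ rank h → VAll.All Ground ts → ∀ j → app h ss >sq lookup ts j
      grounds-sq r (g VAll.∷ gs) zero    = ground-sq r g
      grounds-sq r (g VAll.∷ gs) (suc j) = grounds-sq r gs j

pattern S3 k  = suc (suc (suc k))
pattern S7 k  = S3 (S3 (suc k))
pattern S14 k = S7 (S7 k)

module Simulation (n D : ℕ) (M : TM) where
  open TM M
  open Runs M

  -- Constructors cf, nil, cons; defined symbols g (main), tl (append a word
  -- to the tape list), mk (initial configuration), find (table lookup), step,
  -- disp (dispatch on the scanned symbol), act, mvL, mvR (perform an action),
  -- out, rd (read the output) and it₀ … it_D (iteration levels).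
  arityF : Fin (14 + suc D) → ℕ
  arityF zero                           = 4   -- cf
  arityF (suc zero)                     = 0   -- nil
  arityF (suc (suc zero))               = 2   -- cons
  arityF (S3 zero)                      = n   -- g
  arityF (S3 (suc zero))                = 2   -- tl
  arityF (S3 (suc (suc zero)))          = 2   -- mk
  arityF (S3 (S3 zero))                 = 2   -- find
  arityF (S7 zero)                      = 2   -- step
  arityF (S7 (suc zero))                = 5   -- disp
  arityF (S7 (suc (suc zero)))          = 5   -- act
  arityF (S7 (S3 zero))                 = 4   -- mvL
  arityF (S7 (S3 (suc zero)))           = 4   -- mvR
  arityF (S7 (S3 (suc (suc zero))))     = 1   -- out
  arityF (S7 (S3 (S3 zero)))            = 1   -- rd
  arityF (S14 k)                        = 4   -- it_k

  defF : Fin (14 + suc D) → Bool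
  defF zero             = false
  defF (suc zero)       = false
  defF (suc (suc zero)) = false
  defF (S3 k)           = true

  sig : Signature
  sig = record { nsym = 14 + suc D ; arity = arityF ; defined = defF }

  open Sig sig public renaming (cong to ⟶ᵢ-cong)
  open Rewriting sig public

  pattern cfS   = sym′ zero
  pattern nilS  = sym′ (suc zero)
  pattern consS = sym′ (suc (suc zero))
  pattern gS    = sym′ (S3 zero)
  pattern tlS   = sym′ (S3 (suc zero))
  pattern mkS   = sym′ (S3 (suc (suc zero)))
  pattern findS = sym′ (S3 (S3 zero))
  pattern stepS = sym′ (S7 zero)
  pattern dispS = sym′ (S7 (suc zero))
  pattern actS  = sym′ (S7 (suc (suc zero)))
  pattern mvLS  = sym′ (S7 (S3 zero))
  pattern mvRS  = sym′ (S7 (S3 (suc zero)))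
  pattern outS  = sym′ (S7 (S3 (suc (suc zero))))
  pattern rdS   = sym′ (S7 (S3 (S3 zero)))
  pattern itS k = sym′ (S14 k)

  E : Term
  E = app ε̂ []

  S1 S2 : Term → Term
  S1 t = app ŝ₁ (t ∷ [])
  S2 t = app ŝ₂ (t ∷ [])

  NIL : Term
  NIL = app nilS []

  CONS TL MK FIND STEP : Term → Term → Term
  CONS a b = app consS (a ∷ b ∷ [])
  TL   a b = app tlS (a ∷ b ∷ [])
  MK   a b = app mkS (a ∷ b ∷ [])
  FIND a b = app findS (a ∷ b ∷ [])
  STEP a b = app stepS (a ∷ b ∷ [])

  CF MVL MVR : Term → Term → Term → Term → Term
  CF  q l a r = app cfS (q ∷ l ∷ a ∷ r ∷ [])
  MVL q l a r = app mvLS (q ∷ l ∷ a ∷ r ∷ [])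
  MVR q l a r = app mvRS (q ∷ l ∷ a ∷ r ∷ [])

  DISP ACT : Term → Term → Term → Term → Term → Term
  DISP e q l a r = app dispS (e ∷ q ∷ l ∷ a ∷ r ∷ [])
  ACT  e q l a r = app actS (e ∷ q ∷ l ∷ a ∷ r ∷ [])

  OUT RD : Term → Term
  OUT c = app outS (c ∷ [])
  RD  l = app rdS (l ∷ [])

  IT : Fin (suc D) → Term → Term → Term → Term → Term
  IT k m ns t c = app (itS k) (m ∷ ns ∷ t ∷ c ∷ [])

  -- States and tape symbols are encoded in unary, tapes as lists, and a
  -- configuration as cf(state, left part, scanned symbol, right part).
  unary : ℕ → Term
  unary zero    = E
  unary (suc k) = S1 (unary k)

  tsym : Fin 4 → Term
  tsym a = unary (toℕ a)

  qsym : Fin Q → Term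
  qsym q = unary (toℕ q)

  lst : List (Fin 4) → Term
  lst []       = NIL
  lst (a ∷ as) = CONS (tsym a) (lst as)

  cfgT : Config Q → Term
  cfgT (conf q l a r) = CF (qsym q) (lst l) (tsym a) (lst r)

  -- The transition table: for each state a cf-tuple holding, per scanned
  -- symbol, nil when the state halts and cons(q′, cons(a′, move)) otherwise.
  mvT : Move → Term
  mvT stay  = E
  mvT left  = S1 E
  mvT right = S1 (S1 E)

  actT : Bool → Fin Q × Fin 4 × Move → Term
  actT true  _              = NIL
  actT false (q′ , a′ , m) = CONS (qsym q′) (CONS (tsym a′) (mvT m))

  entryT : Fin Q → Term
  entryT i = CF (action zero) (action (suc zero)) (action (suc (suc zero))) (action (suc (suc (suc zero))))
    where
      action : Fin 4 → Term
      action a = actT (halting i) (δ i a)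

  entryN : ℕ → Term
  entryN k with k <? Q
  ... | yes k<Q = entryT (fromℕ< k<Q)
  ... | no _    = NIL

  tableFrom : ℕ → ℕ → Term
  tableFrom zero    s = NIL
  tableFrom (suc c) s = CONS (entryN s) (tableFrom c (suc s))

  TBL : Term
  TBL = tableFrom Q 0

  QS : Term
  QS = qsym start

  level : ℕ → Fin (suc D)
  level k with k <? suc D
  ... | yes k<1+D = fromℕ< k<1+D
  ... | no _      = zero

  toℕ-level : ∀ k → k ≤ D → toℕ (level k) ≡ k
  toℕ-level k k≤D with k <? suc D
  ... | yes k<1+D = FinP.toℕ-fromℕ< k<1+D
  ... | no k≮1+D  = ⊥-elim (k≮1+D (s≤s k≤D))

  v : ℕ → Term
  v = var

  -- The rules other than those for g and the iteration symbols; the index in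
  -- the list is noted on the right.
  machineRules : List Rule
  machineRules =
    (TL E (v 0) ⟶ CONS (unary 3) (v 0)) ∷                                                        --  0
    (TL (S1 (v 0)) (v 1) ⟶ CONS (unary 1) (TL (v 0) (v 1))) ∷                                    --  1
    (TL (S2 (v 0)) (v 1) ⟶ CONS (unary 2) (TL (v 0) (v 1))) ∷                                    --  2
    (MK (v 0) NIL ⟶ CF (v 0) NIL E NIL) ∷                                                         --  3
    (MK (v 0) (CONS (v 1) (v 2)) ⟶ CF (v 0) NIL (v 1) (v 2)) ∷                                   --  4
    (FIND (CONS (v 0) (v 1)) E ⟶ v 0) ∷                                                          --  5
    (FIND (CONS (v 0) (v 1)) (S1 (v 2)) ⟶ FIND (v 1) (v 2)) ∷                                    --  6
    (STEP (v 0) (CF (v 1) (v 2) (v 3) (v 4)) ⟶ DISP (FIND (v 0) (v 1)) (v 1) (v 2) (v 3) (v 4)) ∷ --  7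
    (DISP (CF (v 0) (v 1) (v 2) (v 3)) (v 4) (v 5) (unary 0) (v 6) ⟶ ACT (v 0) (v 4) (v 5) (unary 0) (v 6)) ∷  --  8
    (DISP (CF (v 0) (v 1) (v 2) (v 3)) (v 4) (v 5) (unary 1) (v 6) ⟶ ACT (v 1) (v 4) (v 5) (unary 1) (v 6)) ∷  --  9
    (DISP (CF (v 0) (v 1) (v 2) (v 3)) (v 4) (v 5) (unary 2) (v 6) ⟶ ACT (v 2) (v 4) (v 5) (unary 2) (v 6)) ∷  -- 10
    (DISP (CF (v 0) (v 1) (v 2) (v 3)) (v 4) (v 5) (unary 3) (v 6) ⟶ ACT (v 3) (v 4) (v 5) (unary 3) (v 6)) ∷  -- 11
    (ACT NIL (v 0) (v 1) (v 2) (v 3) ⟶ CF (v 0) (v 1) (v 2) (v 3)) ∷                              -- 12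
    (ACT (CONS (v 0) (CONS (v 1) E)) (v 2) (v 3) (v 4) (v 5) ⟶ CF (v 0) (v 3) (v 1) (v 5)) ∷       -- 13
    (ACT (CONS (v 0) (CONS (v 1) (S1 E))) (v 2) (v 3) (v 4) (v 5) ⟶ MVL (v 0) (v 3) (v 1) (v 5)) ∷ -- 14
    (ACT (CONS (v 0) (CONS (v 1) (S1 (S1 E)))) (v 2) (v 3) (v 4) (v 5) ⟶ MVR (v 0) (v 3) (v 1) (v 5)) ∷ -- 15
    (MVL (v 0) NIL (v 1) (v 2) ⟶ CF (v 0) NIL E (CONS (v 1) (v 2))) ∷                              -- 16
    (MVL (v 0) (CONS (v 1) (v 2)) (v 3) (v 4) ⟶ CF (v 0) (v 2) (v 1) (CONS (v 3) (v 4))) ∷         -- 17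
    (MVR (v 0) (v 1) (v 2) NIL ⟶ CF (v 0) (CONS (v 2) (v 1)) E NIL) ∷                              -- 18
    (MVR (v 0) (v 1) (v 2) (CONS (v 3) (v 4)) ⟶ CF (v 0) (CONS (v 2) (v 1)) (v 3) (v 4)) ∷         -- 19
    (OUT (CF (v 0) (v 1) (v 2) (v 3)) ⟶ RD (CONS (v 2) (v 3))) ∷                                   -- 20
    (RD NIL ⟶ E) ∷                                                                                 -- 21
    (RD (CONS E (v 0)) ⟶ E) ∷                                                                      -- 22
    (RD (CONS (unary 1) (v 0)) ⟶ S1 (RD (v 0))) ∷                                                  -- 23
    (RD (CONS (unary 2) (v 0)) ⟶ S2 (RD (v 0))) ∷                                                  -- 24
    (RD (CONS (unary 3) (v 0)) ⟶ E) ∷ []                                                           -- 25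

  -- it_{k+1}(m, ns, t, c) runs it_k(m, m, t, ·) once per element of ns, and
  -- it₀ performs a single step; so it_k(m, m, t, c) performs |m|^k steps.
  iterNil iterCons : ℕ → Rule
  iterNil  k = IT (level (suc k)) (v 0) NIL (v 1) (v 2) ⟶ v 2
  iterCons k = IT (level (suc k)) (v 0) (CONS (v 1) (v 2)) (v 3) (v 4) ⟶
               IT (level k) (v 0) (v 0) (v 3) (IT (level (suc k)) (v 0) (v 2) (v 3) (v 4))

  iterStep : Rule
  iterStep = IT (level 0) (v 0) (v 1) (v 2) (v 3) ⟶ STEP (v 2) (v 3)

  iterRules : ℕ → List Rule
  iterRules zero    = iterStep ∷ []
  iterRules (suc k) = iterNil k ∷ iterCons k ∷ iterRules k

  vars : (s k : ℕ) → Vec Term k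
  vars s zero    = []
  vars s (suc k) = var s ∷ vars (suc s) k

  tlChain : ∀ {k} → Vec Term k → Term
  tlChain []       = NIL
  tlChain (t ∷ ts) = TL t (tlChain ts)

  -- g(x₁,…,xₙ) builds the tape list T = x₁#…xₙ#, the loop list m = [E, E] ++ T
  -- of length |input|+2, runs it_D(m, m, table, initial configuration) and
  -- reads the output.
  mainRhs : Term → Term
  mainRhs tape = OUT (IT (level D) (CONS E (CONS E tape)) (CONS E (CONS E tape)) TBL (MK QS tape))

  mainRule : Rule
  mainRule = app gS (vars 0 n) ⟶ mainRhs (tlChain (vars 0 n))

  R : TRS
  R = iterRules D ++ mainRule ∷ machineRules

  -- The intended interpretation: each defined symbol computes, on encoded
  -- arguments, the value the rules are meant to produce (junk otherwise).
  -- Every rule is an identity under it, so rewriting preserves the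
  -- interpretation; this pins down the only value g(v⃗) can reach.
  Itl : Term → Term → Term
  Itl (app ε̂ [])        y = CONS (unary 3) y
  Itl (app ŝ₁ (x ∷ [])) y = CONS (unary 1) (Itl x y)
  Itl (app ŝ₂ (x ∷ [])) y = CONS (unary 2) (Itl x y)
  Itl _                 y = E

  Imk : Term → Term → Term
  Imk q (app nilS [])            = CF q NIL E NIL
  Imk q (app consS (a ∷ r ∷ [])) = CF q NIL a r
  Imk q _                        = E

  Ifind : Term → Term → Term
  Ifind (app consS (e ∷ t ∷ [])) (app ε̂ [])        = e
  Ifind (app consS (e ∷ t ∷ [])) (app ŝ₁ (q ∷ [])) = Ifind t q
  Ifind _                        _                 = E

  ImvL : Term → Term → Term → Term → Term
  ImvL q (app nilS [])            a r = CF q NIL E (CONS a r)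
  ImvL q (app consS (b ∷ l ∷ [])) a r = CF q l b (CONS a r)
  ImvL _ _                        _ _ = E

  ImvR : Term → Term → Term → Term → Term
  ImvR q l a (app nilS [])            = CF q (CONS a l) E NIL
  ImvR q l a (app consS (b ∷ r ∷ [])) = CF q (CONS a l) b r
  ImvR _ _ _ _                        = E

  Iact : Term → Term → Term → Term → Term → Term
  Iact (app nilS []) q l a r = CF q l a r
  Iact (app consS (q′ ∷ app consS (a′ ∷ app ε̂ [] ∷ []) ∷ [])) q l a r = CF q′ l a′ r
  Iact (app consS (q′ ∷ app consS (a′ ∷ app ŝ₁ (app ε̂ [] ∷ []) ∷ []) ∷ [])) q l a r = ImvL q′ l a′ r
  Iact (app consS (q′ ∷ app consS (a′ ∷ app ŝ₁ (app ŝ₁ (app ε̂ [] ∷ []) ∷ []) ∷ []) ∷ [])) q l a r = ImvR q′ l a′ r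
  Iact _ _ _ _ _ = E

  Idisp : Term → Term → Term → Term → Term → Term
  Idisp (app cfS (e0 ∷ e1 ∷ e2 ∷ e3 ∷ [])) q l (app ε̂ []) r = Iact e0 q l E r
  Idisp (app cfS (e0 ∷ e1 ∷ e2 ∷ e3 ∷ [])) q l (app ŝ₁ (app ε̂ [] ∷ [])) r = Iact e1 q l (unary 1) r
  Idisp (app cfS (e0 ∷ e1 ∷ e2 ∷ e3 ∷ [])) q l (app ŝ₁ (app ŝ₁ (app ε̂ [] ∷ []) ∷ [])) r = Iact e2 q l (unary 2) r
  Idisp (app cfS (e0 ∷ e1 ∷ e2 ∷ e3 ∷ [])) q l (app ŝ₁ (app ŝ₁ (app ŝ₁ (app ε̂ [] ∷ []) ∷ []) ∷ [])) r = Iact e3 q l (unary 3) r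
  Idisp _ _ _ _ _ = E

  Istep : Term → Term → Term
  Istep t (app cfS (q ∷ l ∷ a ∷ r ∷ [])) = Idisp (Ifind t q) q l a r
  Istep _ _                              = E

  Ird : Term → Term
  Ird (app consS (app ŝ₁ (app ε̂ [] ∷ []) ∷ r ∷ []))                = S1 (Ird r)
  Ird (app consS (app ŝ₁ (app ŝ₁ (app ε̂ [] ∷ []) ∷ []) ∷ r ∷ [])) = S2 (Ird r)
  Ird _                                                             = E

  Iout : Term → Term
  Iout (app cfS (q ∷ l ∷ a ∷ r ∷ [])) = Ird (CONS a r)
  Iout _                              = E

  Iiter : ℕ → Term → Term → Term → Term → Term
  Iiter zero    m k                        t c = Istep t c
  Iiter (suc j) m (app nilS [])            t c = c
  Iiter (suc j) m (app consS (x ∷ k ∷ [])) t c = Iiter j m m t (Iiter (suc j) m k t c)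
  Iiter (suc j) m _                        t c = E

  ItlChain : ∀ {k} → Vec Term k → Term
  ItlChain []       = NIL
  ItlChain (t ∷ ts) = Itl t (ItlChain ts)

  Ig : Vec Term n → Term
  Ig ts = Iout (Iiter (toℕ (level D)) m m TBL (Imk QS tape))
    where
      tape = ItlChain ts
      m    = CONS E (CONS E tape)

  I : (f : Sym sig) → Vec Term (ar f) → Term
  I gS                     ts                      = Ig ts
  I tlS                    (x ∷ y ∷ [])            = Itl x y
  I mkS                    (x ∷ y ∷ [])            = Imk x y
  I findS                  (x ∷ y ∷ [])            = Ifind x y
  I stepS                  (x ∷ y ∷ [])            = Istep x y
  I dispS                  (a ∷ b ∷ c ∷ d ∷ e ∷ []) = Idisp a b c d e
  I actS                   (a ∷ b ∷ c ∷ d ∷ e ∷ []) = Iact a b c d e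
  I mvLS                   (a ∷ b ∷ c ∷ d ∷ [])     = ImvL a b c d
  I mvRS                   (a ∷ b ∷ c ∷ d ∷ [])     = ImvR a b c d
  I outS                   (a ∷ [])                = Iout a
  I rdS                    (a ∷ [])                = Ird a
  I (itS k)                (a ∷ b ∷ c ∷ d ∷ [])     = Iiter (toℕ k) a b c d
  I f                      ts                      = app f ts

  open Interpretation I

  I-con : ∀ f us → isDef f ≡ false → I f us ≡ app f us
  I-con ε̂                    us d = refl
  I-con ŝ₁                   us d = refl
  I-con ŝ₂                   us d = refl
  I-con cfS                  us d = refl
  I-con nilS                 us d = refl
  I-con consS                us d = refl
  I-con (sym′ (S3 k))        us ()

  ev-tlChain : ∀ env {k} (ts : Vec Term k) → ev env (tlChain ts) ≡ ItlChain (evs env ts)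
  ev-tlChain env []       = refl
  ev-tlChain env (t ∷ ts) = cong (Itl (ev env t)) (ev-tlChain env ts)

  ground-unary : ∀ k → Ground (unary k)
  ground-unary zero    = ground refl VAll.[]
  ground-unary (suc k) = ground refl (ground-unary k VAll.∷ VAll.[])

  ground-cons : ∀ {a b} → Ground a → Ground b → Ground (CONS a b)
  ground-cons a b = ground refl (a VAll.∷ b VAll.∷ VAll.[])

  ground-cf : ∀ {q l a r} → Ground q → Ground l → Ground a → Ground r → Ground (CF q l a r)
  ground-cf q l a r = ground refl (q VAll.∷ l VAll.∷ a VAll.∷ r VAll.∷ VAll.[])

  ground-list : ∀ xs → Ground (lst xs)
  ground-list []       = ground refl VAll.[]
  ground-list (x ∷ xs) = ground-cons (ground-unary _) (ground-list xs)

  ground-config : ∀ c → Ground (cfgT c)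
  ground-config (conf q l a r) = ground-cf (ground-unary _) (ground-list l) (ground-unary _) (ground-list r)

  ground-action : ∀ b x → Ground (actT b x)
  ground-action true  _               = ground refl VAll.[]
  ground-action false (q , a , stay)  = ground-cons (ground-unary _) (ground-cons (ground-unary _) (ground-unary 0))
  ground-action false (q , a , left)  = ground-cons (ground-unary _) (ground-cons (ground-unary _) (ground-unary 1))
  ground-action false (q , a , right) = ground-cons (ground-unary _) (ground-cons (ground-unary _) (ground-unary 2))

  ground-entry : ∀ i → Ground (entryT i)
  ground-entry i = ground-cf (ground-action _ _) (ground-action _ _) (ground-action _ _) (ground-action _ _)

  ground-table : ∀ c s → Ground (tableFrom c s)
  ground-table zero    s = ground refl VAll.[]
  ground-table (suc c) s = ground-cons entry (ground-table c (suc s))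
    where
      entry : Ground (entryN s)
      entry with s <? Q
      ... | yes _ = ground-entry _
      ... | no _  = ground refl VAll.[]

  sound-machine : All Sound machineRules
  sound-machine =
    (λ _ → refl) ∷ (λ _ → refl) ∷ (λ _ → refl) ∷ (λ _ → refl) ∷ (λ _ → refl) ∷
    (λ _ → refl) ∷ (λ _ → refl) ∷ (λ _ → refl) ∷ (λ _ → refl) ∷ (λ _ → refl) ∷
    (λ _ → refl) ∷ (λ _ → refl) ∷ (λ _ → refl) ∷ (λ _ → refl) ∷ (λ _ → refl) ∷
    (λ _ → refl) ∷ (λ _ → refl) ∷ (λ _ → refl) ∷ (λ _ → refl) ∷ (λ _ → refl) ∷
    (λ _ → refl) ∷ (λ _ → refl) ∷ (λ _ → refl) ∷ (λ _ → refl) ∷ (λ _ → refl) ∷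
    (λ _ → refl) ∷ []

  sound-main : Sound mainRule
  sound-main env
    rewrite ev-tlChain env (vars 0 n)
          | ev-ground I-con env (ground-table Q 0)
          | ev-ground I-con env (ground-unary (toℕ start)) = refl

  sound-iter : ∀ k → k ≤ D → All Sound (iterRules k)
  sound-iter zero    _   = sound-step ∷ []
    where
      sound-step : Sound iterStep
      sound-step env rewrite toℕ-level 0 z≤n = refl
  sound-iter (suc k) k<D = sound-nil ∷ sound-cons ∷ sound-iter k (<⇒≤ k<D)
    where
      sound-nil : Sound (iterNil k)
      sound-nil env rewrite toℕ-level (suc k) k<D = refl
      sound-cons : Sound (iterCons k)
      sound-cons env rewrite toℕ-level (suc k) k<D | toℕ-level k (<⇒≤ k<D) = refl

  sound : All Sound R
  sound = LAllP.++⁺ (sound-iter D ≤-refl) (sound-main ∷ sound-machine)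

  vars-values : ∀ s k → T (areValues? (vars s k))
  vars-values s zero    = tt
  vars-values s (suc k) = vars-values (suc s) k

  basic-iter : ∀ k → All (T ∘ isBasic? ∘ lhs) (iterRules k)
  basic-iter zero    = tt ∷ []
  basic-iter (suc k) = tt ∷ tt ∷ basic-iter k

  constructor-TRS : ConstructorTRS R
  constructor-TRS {ρ} ρ∈R = basic-criterion (lhs ρ) (LAll.lookup lhs-basic ρ∈R)
    where
      lhs-basic : All (T ∘ isBasic? ∘ lhs) R
      lhs-basic = LAllP.++⁺ (basic-iter D) (vars-values 0 n ∷ LAllP.all⁺ (isBasic? ∘ lhs) machineRules _)

  open Reduction R

  infix 4 _⇒*_
  _⇒*_ : Term → Term → Set
  a ⇒* b = R ⊢ a ⟶ᵢ* b

  grounds-normal : ∀ {k} {ts : Vec Term k} → VAll.All Ground ts → VAll.All (NF R) ts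
  grounds-normal = VAll.map (value-normal constructor-TRS ∘ ground-value)

  rule-step : ∀ {ρ} → ρ ∈ R → (σ : Subst) → ∀ {f ts} → sub σ (lhs ρ) ≡ app f ts →
              VAll.All Ground ts → sub σ (lhs ρ) ⇒* sub σ (rhs ρ)
  rule-step ρ∈R σ e gs = root ρ∈R σ e (grounds-normal gs) ◅ Star.ε

  machine-step : (k : Fin 26) (σ : Subst) → ∀ {f ts} → sub σ (lhs (L.lookup machineRules k)) ≡ app f ts →
                 VAll.All Ground ts → sub σ (lhs (L.lookup machineRules k)) ⇒* sub σ (rhs (L.lookup machineRules k))
  machine-step k = rule-step (∈-++⁺ʳ (iterRules D) (there (∈-lookup k)))

  inst : List Term → Subst
  inst []       _       = E
  inst (t ∷ ts) zero    = t
  inst (t ∷ ts) (suc k) = inst ts k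

  infixr 5 _▸_
  _▸_ : ∀ {a b c} → a ⇒* b → b ⇒* c → a ⇒* c
  _▸_ = _◅◅_

  tl-reduces : ∀ w xs → TL (enc w) (lst xs) ⇒* lst (wordSyms w ++ sep ∷ xs)
  tl-reduces ε xs = machine-step (# 0) (inst (lst xs ∷ [])) refl
    (ground-unary 0 VAll.∷ ground-list xs VAll.∷ VAll.[])
  tl-reduces (S₁ w) xs = machine-step (# 1) (inst (enc w ∷ lst xs ∷ [])) refl
    (enc-ground (S₁ w) VAll.∷ ground-list xs VAll.∷ VAll.[])
    ▸ reduce-arg (# 1) (tl-reduces w xs)
  tl-reduces (S₂ w) xs = machine-step (# 2) (inst (enc w ∷ lst xs ∷ [])) refl
    (enc-ground (S₂ w) VAll.∷ ground-list xs VAll.∷ VAll.[])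
    ▸ reduce-arg (# 1) (tl-reduces w xs)

  tape-reduces : ∀ {k} (vs : Vec W k) → tlChain (V.map enc vs) ⇒* lst (inputSyms vs)
  tape-reduces []       = Star.ε
  tape-reduces (w ∷ vs) = reduce-arg (# 1) (tape-reduces vs) ▸ tl-reduces w (inputSyms vs)

  mk-reduces : ∀ xs → MK QS (lst xs) ⇒* cfgT (initConfig M xs)
  mk-reduces []       = machine-step (# 3) (inst (QS ∷ [])) refl
    (ground-unary _ VAll.∷ ground-list [] VAll.∷ VAll.[])
  mk-reduces (a ∷ as) = machine-step (# 4) (inst (QS ∷ tsym a ∷ lst as ∷ [])) refl
    (ground-unary _ VAll.∷ ground-list (a ∷ as) VAll.∷ VAll.[])

  find-reduces : ∀ c s k → k < c → FIND (tableFrom c s) (unary k) ⇒* entryN (s + k)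
  find-reduces (suc c) s zero _ rewrite +-identityʳ s =
    machine-step (# 5) (inst (entryN s ∷ tableFrom c (suc s) ∷ [])) refl
      (ground-table (suc c) s VAll.∷ ground-unary 0 VAll.∷ VAll.[])
  find-reduces (suc c) s (suc k) (s≤s k<c) rewrite +-suc s k =
    machine-step (# 6) (inst (entryN s ∷ tableFrom c (suc s) ∷ unary k ∷ [])) refl
      (ground-table (suc c) s VAll.∷ ground-unary (suc k) VAll.∷ VAll.[])
    ▸ find-reduces c (suc s) k k<c

  entryN-toℕ : ∀ i → entryN (toℕ i) ≡ entryT i
  entryN-toℕ i with toℕ i <? Q
  ... | yes i<Q = cong entryT (FinP.fromℕ<-toℕ i i<Q)
  ... | no i≮Q  = ⊥-elim (i≮Q (FinP.toℕ<n i))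

  table-lookup : ∀ i → FIND TBL (qsym i) ⇒* entryT i
  table-lookup i = subst (FIND TBL (qsym i) ⇒*_) (entryN-toℕ i) (find-reduces Q 0 (toℕ i) (FinP.toℕ<n i))

  mvL-reduces : ∀ q l a r → MVL (qsym q) (lst l) (tsym a) (lst r) ⇒* cfgT (doMove q l a r left)
  mvL-reduces q []      a r = machine-step (# 16) (inst (qsym q ∷ tsym a ∷ lst r ∷ [])) refl
    (ground-unary _ VAll.∷ ground-list [] VAll.∷ ground-unary _ VAll.∷ ground-list r VAll.∷ VAll.[])
  mvL-reduces q (b ∷ l) a r = machine-step (# 17) (inst (qsym q ∷ tsym b ∷ lst l ∷ tsym a ∷ lst r ∷ [])) refl
    (ground-unary _ VAll.∷ ground-list (b ∷ l) VAll.∷ ground-unary _ VAll.∷ ground-list r VAll.∷ VAll.[])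

  mvR-reduces : ∀ q l a r → MVR (qsym q) (lst l) (tsym a) (lst r) ⇒* cfgT (doMove q l a r right)
  mvR-reduces q l a []      = machine-step (# 18) (inst (qsym q ∷ lst l ∷ tsym a ∷ [])) refl
    (ground-unary _ VAll.∷ ground-list l VAll.∷ ground-unary _ VAll.∷ ground-list [] VAll.∷ VAll.[])
  mvR-reduces q l a (b ∷ r) = machine-step (# 19) (inst (qsym q ∷ lst l ∷ tsym a ∷ tsym b ∷ lst r ∷ [])) refl
    (ground-unary _ VAll.∷ ground-list l VAll.∷ ground-unary _ VAll.∷ ground-list (b ∷ r) VAll.∷ VAll.[])

  act-arguments-ground : ∀ {e} q l a r → Ground e →
                         VAll.All Ground (e ∷ qsym q ∷ lst l ∷ tsym a ∷ lst r ∷ [])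
  act-arguments-ground q l a r e =
    e VAll.∷ ground-unary _ VAll.∷ ground-list l VAll.∷ ground-unary _ VAll.∷ ground-list r VAll.∷ VAll.[]

  move-inst : Fin Q → Fin 4 → Fin Q → List (Fin 4) → Fin 4 → List (Fin 4) → Subst
  move-inst q′ a′ i l a r = inst (qsym q′ ∷ tsym a′ ∷ qsym i ∷ lst l ∷ tsym a ∷ lst r ∷ [])

  act-reduces : ∀ i l a r →
    ACT (actT (halting i) (δ i a)) (qsym i) (lst l) (tsym a) (lst r) ⇒* cfgT (step M (conf i l a r))
  act-reduces i l a r with halting i
  ... | true = machine-step (# 12) (inst (qsym i ∷ lst l ∷ tsym a ∷ lst r ∷ [])) refl
                 (act-arguments-ground i l a r (ground-action true (δ i a)))
  ... | false with δ i a
  ...   | (q′ , a′ , stay)  = machine-step (# 13) (move-inst q′ a′ i l a r) refl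
                                (act-arguments-ground i l a r (ground-action false (q′ , a′ , stay)))
  ...   | (q′ , a′ , left)  = machine-step (# 14) (move-inst q′ a′ i l a r) refl
                                (act-arguments-ground i l a r (ground-action false (q′ , a′ , left)))
                              ▸ mvL-reduces q′ l a′ r
  ...   | (q′ , a′ , right) = machine-step (# 15) (move-inst q′ a′ i l a r) refl
                                (act-arguments-ground i l a r (ground-action false (q′ , a′ , right)))
                              ▸ mvR-reduces q′ l a′ r

  disp-reduces : ∀ i l a r → DISP (entryT i) (qsym i) (lst l) (tsym a) (lst r) ⇒* cfgT (step M (conf i l a r))
  disp-reduces i l a r = select a ▸ act-reduces i l a r
    where
      action : Fin 4 → Term
      action b = actT (halting i) (δ i b)
      σ : Subst
      σ = inst (action (# 0) ∷ action (# 1) ∷ action (# 2) ∷ action (# 3) ∷ qsym i ∷ lst l ∷ lst r ∷ [])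
      arguments-ground : ∀ a → VAll.All Ground (entryT i ∷ qsym i ∷ lst l ∷ tsym a ∷ lst r ∷ [])
      arguments-ground a = act-arguments-ground i l a r (ground-entry i)
      select : ∀ a → DISP (entryT i) (qsym i) (lst l) (tsym a) (lst r) ⇒* ACT (action a) (qsym i) (lst l) (tsym a) (lst r)
      select zero                   = machine-step (# 8)  σ refl (arguments-ground zero)
      select (suc zero)             = machine-step (# 9)  σ refl (arguments-ground (# 1))
      select (suc (suc zero))       = machine-step (# 10) σ refl (arguments-ground (# 2))
      select (suc (suc (suc zero))) = machine-step (# 11) σ refl (arguments-ground (# 3))

  step-reduces : ∀ c → STEP TBL (cfgT c) ⇒* cfgT (step M c)
  step-reduces (conf i l a r) =
    machine-step (# 7) (inst (TBL ∷ qsym i ∷ lst l ∷ tsym a ∷ lst r ∷ [])) refl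
      (ground-table Q 0 VAll.∷ ground-config (conf i l a r) VAll.∷ VAll.[])
    ▸ reduce-arg (# 0) (table-lookup i)
    ▸ disp-reduces i l a r

  rd-reduces : ∀ xs → RD (lst xs) ⇒* enc (readW xs)
  rd-reduces []                          = machine-step (# 21) (inst []) refl (ground-list [] VAll.∷ VAll.[])
  rd-reduces (zero ∷ xs)                 = machine-step (# 22) (inst (lst xs ∷ [])) refl
    (ground-list (zero ∷ xs) VAll.∷ VAll.[])
  rd-reduces (suc zero ∷ xs)             = machine-step (# 23) (inst (lst xs ∷ [])) refl
    (ground-list (suc zero ∷ xs) VAll.∷ VAll.[])
    ▸ reduce-arg (# 0) (rd-reduces xs)
  rd-reduces (suc (suc zero) ∷ xs)       = machine-step (# 24) (inst (lst xs ∷ [])) refl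
    (ground-list (suc (suc zero) ∷ xs) VAll.∷ VAll.[])
    ▸ reduce-arg (# 0) (rd-reduces xs)
  rd-reduces (suc (suc (suc zero)) ∷ xs) = machine-step (# 25) (inst (lst xs ∷ [])) refl
    (ground-list (suc (suc (suc zero)) ∷ xs) VAll.∷ VAll.[])

  out-reduces : ∀ c → OUT (cfgT c) ⇒* enc (output c)
  out-reduces (conf q l a r) =
    machine-step (# 20) (inst (qsym q ∷ lst l ∷ tsym a ∷ lst r ∷ [])) refl
      (ground-config (conf q l a r) VAll.∷ VAll.[])
    ▸ rd-reduces (a ∷ r)

  iter-∈ : ∀ d {j ρ} → ρ ∈ iterRules j → ρ ∈ iterRules (d + j)
  iter-∈ zero    ρ∈ = ρ∈
  iter-∈ (suc d) ρ∈ = there (there (iter-∈ d ρ∈))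

  iter-∈-R : ∀ {j ρ} → j ≤ D → ρ ∈ iterRules j → ρ ∈ R
  iter-∈-R {j} {ρ} j≤D ρ∈ = ∈-++⁺ˡ (subst (λ k → ρ ∈ iterRules k) (m∸n+n≡m j≤D) (iter-∈ (D ∸ j) ρ∈))

  -- The number of steps performed by it_k(m, ns, table, c) when |ns| = a and |m| = L.
  loops : ℕ → ℕ → ℕ → ℕ
  loops zero    a L = 1
  loops (suc k) a L = a * loops k L L

  loops-power : ∀ k L → loops k L L ≡ L ^ k
  loops-power zero    L = refl
  loops-power (suc k) L = cong (L *_) (loops-power k L)

  iter-reduces : ∀ k → k ≤ D → ∀ ms ns c →
                 IT (level k) (lst ms) (lst ns) TBL (cfgT c) ⇒* cfgT (run M (loops k (length ns) (length ms)) c)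
  iter-reduces zero k≤D ms ns c =
    rule-step (iter-∈-R k≤D (here refl)) (inst (lst ms ∷ lst ns ∷ TBL ∷ cfgT c ∷ [])) refl
      (ground-list ms VAll.∷ ground-list ns VAll.∷ ground-table Q 0 VAll.∷ ground-config c VAll.∷ VAll.[])
    ▸ step-reduces c
  iter-reduces (suc k) k<D ms [] c =
    rule-step (iter-∈-R k<D (here refl)) (inst (lst ms ∷ TBL ∷ cfgT c ∷ [])) refl
      (ground-list ms VAll.∷ ground-list [] VAll.∷ ground-table Q 0 VAll.∷ ground-config c VAll.∷ VAll.[])
  iter-reduces (suc k) k<D ms (x ∷ ns) c =
    rule-step (iter-∈-R k<D (there (here refl))) (inst (lst ms ∷ tsym x ∷ lst ns ∷ TBL ∷ cfgT c ∷ [])) refl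
      (ground-list ms VAll.∷ ground-list (x ∷ ns) VAll.∷ ground-table Q 0 VAll.∷ ground-config c VAll.∷ VAll.[])
    ▸ reduce-arg (# 3) (iter-reduces (suc k) k<D ms ns c)
    ▸ subst (λ c′ → IT (level k) (lst ms) (lst ms) TBL (cfgT (run M rest c)) ⇒* cfgT c′) runs-compose
        (iter-reduces k (<⇒≤ k<D) ms ms (run M rest c))
    where
      once = loops k (length ms) (length ms)
      rest = length ns * once
      runs-compose : run M once (run M rest c) ≡ run M (once + rest) c
      runs-compose = trans (sym (run-+ rest once c)) (cong (λ t → run M t c) (+-comm rest once))

  subs-vars : ∀ {k} (us : Vec Term k) σ s → (∀ x → σ (s + x) ≡ inst (V.toList us) x) → subs σ (vars s k) ≡ us
  subs-vars []       σ s h = refl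
  subs-vars (u ∷ us) σ s h =
    cong₂ _∷_ (trans (cong σ (sym (+-identityʳ s))) (h 0))
              (subs-vars us σ (suc s) (λ x → trans (cong σ (sym (+-suc s x))) (h (suc x))))

  sub-tlChain : ∀ σ {k} (ts : Vec Term k) → sub σ (tlChain ts) ≡ tlChain (subs σ ts)
  sub-tlChain σ []       = refl
  sub-tlChain σ (t ∷ ts) = cong (TL (sub σ t)) (sub-tlChain σ ts)

  main-step : (us : Vec Term n) → VAll.All Ground us → app gS us ⇒* mainRhs (tlChain us)
  main-step us gs = subst₂ _⇒*_ (cong (app gS) subs≡us) instance-rhs
    (rule-step (∈-++⁺ʳ (iterRules D) (here refl)) σ refl (subst (VAll.All Ground) (sym subs≡us) gs))
    where
      σ = inst (V.toList us)
      subs≡us : subs σ (vars 0 n) ≡ us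
      subs≡us = subs-vars us σ 0 (λ _ → refl)
      instance-rhs : sub σ (rhs mainRule) ≡ mainRhs (tlChain us)
      instance-rhs rewrite sub-tlChain σ (vars 0 n) | subs≡us
                         | sub-ground σ (ground-table Q 0) | sub-ground σ (ground-unary (toℕ start)) = refl

  loopLength : Vec W n → ℕ
  loopLength vs = 2 + length (inputSyms vs)

  main-reduces : ∀ vs → app gS (V.map enc vs) ⇒*
                 enc (output (run M (loopLength vs ^ D) (initConfig M (inputSyms vs))))
  main-reduces vs =
    main-step us (encs-ground vs)
    ▸ reduce-arg (# 0) (reduce-arg (# 0) loop-list ▸ reduce-arg (# 1) loop-list
                        ▸ reduce-arg (# 3) (reduce-arg (# 1) (tape-reduces vs) ▸ mk-reduces xs)
                        ▸ subst (λ t → IT (level D) (lst ms) (lst ms) TBL (cfgT (initConfig M xs)) ⇒*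
                                       cfgT (run M t (initConfig M xs)))
                                (loops-power D (length ms))
                                (iter-reduces D ≤-refl ms ms (initConfig M xs)))
    ▸ out-reduces _
    where
      us = V.map enc vs
      xs = inputSyms vs
      ms = blank ∷ blank ∷ xs
      loop-list : CONS E (CONS E (tlChain us)) ⇒* lst ms
      loop-list = reduce-arg (# 1) (reduce-arg (# 1) (tape-reduces vs))

  -- If M's output after loopLength(v⃗)^D steps is f(v⃗), then R computes f
  -- via g: the reduction above reaches enc(f v⃗), and since reduction
  -- preserves the interpretation, every value reached from g(v⃗) equals it.
  computes : (f : Vec W n → W) →
             (∀ vs → output (run M (loopLength vs ^ D) (initConfig M (inputSyms vs))) ≡ f vs) →
             Computes R f
  computes f runs-to-f = gS , refl , refl , λ vs w → mk⇔ (unique vs w) (reaches vs w)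
    where
      reaches-f : ∀ vs → app gS (V.map enc vs) ⇒* enc (f vs)
      reaches-f vs = subst (λ w → app gS (V.map enc vs) ⇒* enc w) (runs-to-f vs) (main-reduces vs)

      unique : ∀ vs w → ⟦ R ⟧ gS refl vs w → f vs ≡ w
      unique vs w (reaches-w , _ , _) = enc-injective (begin
        enc (f vs)                     ≡⟨ ev-ground I-con var (enc-ground (f vs)) ⟨
        ev var (enc (f vs))            ≡⟨ ev-steps sound (reaches-f vs) ⟨
        ev var (app gS (V.map enc vs)) ≡⟨ ev-steps sound reaches-w ⟩
        ev var (enc w)                 ≡⟨ ev-ground I-con var (enc-ground w) ⟩
        enc w                          ∎)
        where open ≡-Reasoning

      reaches : ∀ vs w → f vs ≡ w → ⟦ R ⟧ gS refl vs w
      reaches vs w refl = reaches-f vs , ground-value (enc-ground (f vs)) ,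
                          value-normal constructor-TRS (ground-value (enc-ground (f vs)))

  -- R is well formed and left-linear: the iteration and machine rules pass the
  -- evaluable criteria (their variables are below 10); the rule for g is
  -- treated separately since its arity n is arbitrary.
  criteria-iter : ∀ k → All (λ ρ → T (linear? 10 (lhs ρ)) × T (variableCondition? 10 (lhs ρ) (rhs ρ))) (iterRules k)
  criteria-iter zero    = (tt , tt) ∷ []
  criteria-iter (suc k) = (tt , tt) ∷ (tt , tt) ∷ criteria-iter k

  criteria-machine : All (λ ρ → T (linear? 10 (lhs ρ)) × T (variableCondition? 10 (lhs ρ) (rhs ρ))) machineRules
  criteria-machine = LAll.map (λ {ρ} → T-∧⁻ {linear? 10 (lhs ρ)})
                       (LAllP.all⁺ (λ ρ → linear? 10 (lhs ρ) ∧ variableCondition? 10 (lhs ρ) (rhs ρ)) machineRules _)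

  vars-fresh : ∀ s k x → x < s → occurrencesᵛ (vars s k) x ≡ 0
  vars-fresh s zero    x x<s = refl
  vars-fresh s (suc k) x x<s with s ≡ᵇ x in eq
  ... | true  = ⊥-elim (<-irrefl (sym (≡ᵇ⇒≡ s x (Equivalence.from T-≡ eq))) x<s)
  ... | false = vars-fresh (suc s) k x (≤-trans x<s (n≤1+n s))

  vars-linear : ∀ s k x → occurrencesᵛ (vars s k) x ≤ 1
  vars-linear s zero    x = z≤n
  vars-linear s (suc k) x with s ≡ᵇ x in eq
  ... | true rewrite ≡ᵇ⇒≡ s x (Equivalence.from T-≡ eq) | vars-fresh (suc x) k x ≤-refl = ≤-refl
  ... | false = vars-linear (suc s) k x

  tlChain-occurs : ∀ {x k} (ts : Vec Term k) → x ∈V tlChain ts → Σ (Fin k) λ i → x ∈V lookup ts i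
  tlChain-occurs []       (there () _)
  tlChain-occurs (t ∷ ts) (there zero o)       = zero , o
  tlChain-occurs (t ∷ ts) (there (suc zero) o) = let i , o′ = tlChain-occurs ts o in suc i , o′

  tape-occurs : ∀ {x} → x ∈V tlChain (vars 0 n) → x ∈V lhs mainRule
  tape-occurs o = let i , o′ = tlChain-occurs (vars 0 n) o in there i o′

  loop-list-occurs : ∀ {x} → x ∈V CONS E (CONS E (tlChain (vars 0 n))) → x ∈V lhs mainRule
  loop-list-occurs (there zero (there () _))
  loop-list-occurs (there (suc zero) (there zero (there () _)))
  loop-list-occurs (there (suc zero) (there (suc zero) o)) = tape-occurs o

  main-variables : ∀ x → x ∈V rhs mainRule → x ∈V lhs mainRule
  main-variables x (there zero (there zero o))                   = loop-list-occurs o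
  main-variables x (there zero (there (suc zero) o))             = loop-list-occurs o
  main-variables x (there zero (there (suc (suc zero)) o))       = ⊥-elim (ground-no-var (ground-table Q 0) o)
  main-variables x (there zero (there (suc (suc (suc zero))) (there zero o))) =
    ⊥-elim (ground-no-var (ground-unary (toℕ start)) o)
  main-variables x (there zero (there (suc (suc (suc zero))) (there (suc zero) o))) = tape-occurs o

  well-formed : WellFormed R
  well-formed {ρ} ρ∈R = basic-not-var (constructor-TRS ρ∈R) , LAll.lookup variable-conditions ρ∈R
    where
      variable-conditions : All (λ ρ → ∀ x → x ∈V rhs ρ → x ∈V lhs ρ) R
      variable-conditions =
        LAllP.++⁺ (LAll.map (λ {ρ} (_ , c) → variable-criterion 10 (lhs ρ) (rhs ρ) c) (criteria-iter D))
                  (main-variables ∷ LAll.map (λ {ρ} (_ , c) → variable-criterion 10 (lhs ρ) (rhs ρ) c) criteria-machine)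

  left-linear : LeftLinear R
  left-linear ρ∈R = LAll.lookup linear ρ∈R
    where
      linear : All (Linear ∘ lhs) R
      linear =
        LAllP.++⁺ (LAll.map (λ {ρ} (l , _) → linear-criterion 10 (lhs ρ) l) (criteria-iter D))
                  ((λ p q x → single-position (lhs mainRule) p q x (vars-linear 0 n x))
                   ∷ LAll.map (λ {ρ} (l , _) → linear-criterion 10 (lhs ρ) l) criteria-machine)

  distinct-levels : ∀ {a b} → a ≢ b → a ≤ D → b ≤ D → T (not (itS (level a) ==ˢ itS (level b)))
  distinct-levels {a} {b} a≢b a≤D b≤D = Equivalence.from T-not-≡ (¬-not same-level⇒equal)
    where
      same-level⇒equal : (itS (level a) ==ˢ itS (level b)) ≢ true
      same-level⇒equal same = a≢b (begin
        a                ≡⟨ toℕ-level a a≤D ⟨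
        toℕ (level a)    ≡⟨ ≡ᵇ⇒≡ (toℕ (level a)) (toℕ (level b)) (Equivalence.from T-≡ same) ⟩
        toℕ (level b)    ≡⟨ toℕ-level b b≤D ⟩
        b                ∎)
        where open ≡-Reasoning

  lower-levels-clash : ∀ m (ts : Vec Term 4) → m ≤ D → ∀ k → k < m →
                       All (λ ρ → T (clash (app (itS (level m)) ts) (lhs ρ))) (iterRules k)
  lower-levels-clash m ts m≤D zero 0<m =
    clash-roots {itS (level m)} {itS (level 0)} ts _
      (distinct-levels (λ m≡0 → <-irrefl (sym m≡0) 0<m) m≤D z≤n) ∷ []
  lower-levels-clash m ts m≤D (suc k) k<m =
    clash-roots {itS (level m)} {itS (level (suc k))} ts _ different
    ∷ clash-roots {itS (level m)} {itS (level (suc k))} ts _ different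
    ∷ lower-levels-clash m ts m≤D k (<-trans (n<1+n k) k<m)
    where
      different = distinct-levels (λ m≡1+k → <-irrefl (sym m≡1+k) k<m) m≤D (≤-trans (<⇒≤ k<m) m≤D)

  -- The two rules of a positive level clash in their list argument.
  iter-clashes : ∀ k → k ≤ D → AllPairs Clash (iterRules k)
  iter-clashes zero    _   = [] ∷ []
  iter-clashes (suc k) k<D =
    (clash-arguments {itS (level (suc k))} nil-args cons-args tt ∷ lower-levels-clash (suc k) nil-args k<D k ≤-refl)
    ∷ lower-levels-clash (suc k) cons-args k<D k ≤-refl
    ∷ iter-clashes k (<⇒≤ k<D)
    where
      nil-args cons-args : Vec Term 4
      nil-args  = v 0 ∷ NIL ∷ v 1 ∷ v 2 ∷ []
      cons-args = v 0 ∷ CONS (v 1) (v 2) ∷ v 3 ∷ v 4 ∷ []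

  non-overlapping-R : NonOverlapping R
  non-overlapping-R = non-overlapping constructor-TRS
    (AllPairsP.++⁺ (iter-clashes D ≤-refl)
                   (toWitness {a? = AllPairs.allPairs? (λ ρ ρ′ → T? (clash (lhs ρ) (lhs ρ′))) (mainRule ∷ machineRules)} tt)
                   (iter-vs-rest D))
    where
      iter-vs-rest : ∀ k → All (λ ρ → All (Clash ρ) (mainRule ∷ machineRules)) (iterRules k)
      iter-vs-rest zero    = LAllP.all⁺ _ (mainRule ∷ machineRules) _ ∷ []
      iter-vs-rest (suc k) = LAllP.all⁺ _ (mainRule ∷ machineRules) _ ∷ LAllP.all⁺ _ (mainRule ∷ machineRules) _ ∷ iter-vs-rest k

  safeF : SafeMapping
  safeF gS      _       = false
  safeF tlS     zero    = false
  safeF tlS     (suc _) = true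
  safeF findS   zero    = false
  safeF findS   (suc _) = true
  safeF stepS   zero    = false
  safeF stepS   (suc _) = true
  safeF outS    _       = false
  safeF rdS     _       = false
  safeF (itS k) (S3 _)  = true
  safeF (itS k) _       = false
  safeF _       _       = true

  safe-con : IsSafeMapping safeF
  safe-con ε̂             () _
  safe-con ŝ₁            i  _ = refl
  safe-con ŝ₂            i  _ = refl
  safe-con cfS           i  _ = refl
  safe-con nilS          () _
  safe-con consS         i  _ = refl
  safe-con (sym′ (S3 k)) i  ()

  rank : Sym sig → ℕ
  rank gS      = 6 + D
  rank tlS     = 1
  rank mkS     = 1
  rank findS   = 1
  rank mvLS    = 1
  rank mvRS    = 1
  rank rdS     = 1
  rank actS    = 2
  rank outS    = 2
  rank dispS   = 3
  rank stepS   = 4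
  rank (itS k) = 5 + toℕ k
  rank _       = 0

  def-rank : ∀ f → isDef f ≡ positive (rank f)
  def-rank ε̂      = refl
  def-rank ŝ₁     = refl
  def-rank ŝ₂     = refl
  def-rank cfS    = refl
  def-rank nilS   = refl
  def-rank consS  = refl
  def-rank gS     = refl
  def-rank tlS    = refl
  def-rank mkS    = refl
  def-rank findS  = refl
  def-rank stepS  = refl
  def-rank dispS  = refl
  def-rank actS   = refl
  def-rank mvLS   = refl
  def-rank mvRS   = refl
  def-rank outS   = refl
  def-rank rdS    = refl
  def-rank (itS k) = refl

  open RankPrecedence safeF safe-con rank def-rank

  Oriented : Rule → Set
  Oriented ρ = lhs ρ >pop rhs ρ

  value-rhs : ∀ {h ss} r → 1 ≤ rank h → T (isValue? r) → T (variableCondition? 10 (app h ss) r) → app h ss >pop r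
  value-rhs r ranked v c = value-pop ranked (value-criterion r v) (variable-criterion 10 _ r c)

  safe-values-rhs : ∀ {h ss g} ts → rank g < rank h → (∀ j → safeF g j ≡ true) → T (areValues? ts) →
                    T (variableCondition? 10 (app h ss) (app g ts)) → app h ss >pop app g ts
  safe-values-rhs ts g<h all-safe vs c =
    prec-values-pop g<h all-safe (values-criterion ts vs) (variable-criterion 10 _ _ c)

  -- tl(s(x), y) > cons(c, tl(x, y)): the recursive call decreases the normal argument.
  tl-oriented : ∀ {u} c → u >pop v 0 → TL u (v 1) >pop CONS (unary c) (TL (v 0) (v 1))
  tl-oriented {u} c u>x = pop-prec refl (prec< {tlS} {consS} (s≤s z≤n)) (λ _ ()) safe-args one-unbounded
    where
      digit-below : Below tlS (unary c)
      digit-below = value-below (s≤s z≤n) (ground-value (ground-unary c))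
      safe-args : ∀ j → safeF consS j ≡ true → TL u (v 1) >pop lookup (unary c ∷ TL (v 0) (v 1) ∷ []) j
      safe-args zero       _ = ground-pop (s≤s z≤n) (ground-unary c)
      safe-args (suc zero) _ = pop-eq refl (∼-refl {tlS}) (mulGt-single u>x) (mulGe-equal ≈refl)
      one-unbounded : ∀ j k → safeF consS j ≡ true → safeF consS k ≡ true →
                      ¬ Below tlS (lookup (unary c ∷ TL (v 0) (v 1) ∷ []) j) →
                      ¬ Below tlS (lookup (unary c ∷ TL (v 0) (v 1) ∷ []) k) → j ≡ k
      one-unbounded zero       _          _ _ not-below _ = ⊥-elim (not-below digit-below)
      one-unbounded (suc zero) zero       _ _ _ not-below = ⊥-elim (not-below digit-below)
      one-unbounded (suc zero) (suc zero) _ _ _ _         = refl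

  find-oriented : FIND (CONS (v 0) (v 1)) (S1 (v 2)) >pop FIND (v 1) (v 2)
  find-oriented = pop-eq refl (∼-refl {findS})
    (mulGt-single (pop-sub (# 1) (inj₂ ≈refl))) (mulGe-single (pop-sub (# 0) (inj₂ ≈refl)))

  -- step(t, cf(q, l, a, r)) > disp(find(t, q), q, l, a, r): all arguments of
  -- disp are safe and lie in T(F_{<step}, V).
  step-oriented : STEP (v 0) (CF (v 1) (v 2) (v 3) (v 4)) >pop DISP (FIND (v 0) (v 1)) (v 1) (v 2) (v 3) (v 4)
  step-oriented = pop-prec refl (prec< {stepS} {dispS} ≤-refl) (λ _ ()) safe-args
                    (λ j _ _ _ not-below _ → ⊥-elim (not-below (below j)))
    where
      step-lhs = STEP (v 0) (CF (v 1) (v 2) (v 3) (v 4))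
      disp-args = FIND (v 0) (v 1) ∷ v 1 ∷ v 2 ∷ v 3 ∷ v 4 ∷ []
      find-smaller : step-lhs >pop FIND (v 0) (v 1)
      find-smaller = pop-prec refl (prec< {stepS} {findS} (s≤s (s≤s z≤n)))
        (λ { zero _ → sq-sub zero (λ _ → refl) (inj₂ ≈refl) ; (suc zero) () })
        (λ { zero () ; (suc zero) _ → var-pop (there (# 1) (there zero here)) })
        (λ { zero _ () ; (suc zero) zero _ () ; (suc zero) (suc zero) _ _ _ _ → refl })
      safe-args : ∀ j → safeF dispS j ≡ true → step-lhs >pop lookup disp-args j
      safe-args zero                         _ = find-smaller
      safe-args (suc zero)                   _ = var-pop (there (# 1) (there (# 0) here))
      safe-args (suc (suc zero))             _ = var-pop (there (# 1) (there (# 1) here))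
      safe-args (suc (suc (suc zero)))       _ = var-pop (there (# 1) (there (# 2) here))
      safe-args (suc (suc (suc (suc zero)))) _ = var-pop (there (# 1) (there (# 3) here))
      below : ∀ j → Below stepS (lookup disp-args j)
      below zero                         = bapp (prec< {stepS} {findS} (s≤s (s≤s z≤n)))
                                                (λ { zero → bvar 0 ; (suc zero) → bvar 1 })
      below (suc zero)                   = bvar 1
      below (suc (suc zero))             = bvar 2
      below (suc (suc (suc zero)))       = bvar 3
      below (suc (suc (suc (suc zero)))) = bvar 4

  out-oriented : OUT (CF (v 0) (v 1) (v 2) (v 3)) >pop RD (CONS (v 2) (v 3))
  out-oriented = pop-prec refl (prec< {outS} {rdS} ≤-refl) (λ { zero _ → tape-smaller }) (λ { zero () })
                   (λ { zero zero _ _ _ _ → refl })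
    where
      tape-smaller : OUT (CF (v 0) (v 1) (v 2) (v 3)) >sq CONS (v 2) (v 3)
      tape-smaller = sq-prec refl (prec< {outS} {consS} (s≤s z≤n))
        (λ { zero       → sq-sub zero (λ _ → refl) (inj₁ (sq-sub (# 2) (λ ()) (inj₂ ≈refl)))
           ; (suc zero) → sq-sub zero (λ _ → refl) (inj₁ (sq-sub (# 3) (λ ()) (inj₂ ≈refl))) })

  rd-recursion : ∀ c → RD (CONS (unary c) (v 0)) >pop RD (v 0)
  rd-recursion c = pop-eq refl (∼-refl {rdS}) (mulGt-single (pop-sub (# 1) (inj₂ ≈refl))) mulGe-[]

  rd₁-oriented : RD (CONS (unary 1) (v 0)) >pop S1 (RD (v 0))
  rd₁-oriented = pop-prec refl (prec< {rdS} {ŝ₁} ≤-refl) (λ { zero () }) (λ { zero _ → rd-recursion 1 })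
                   (λ { zero zero _ _ _ _ → refl })

  rd₂-oriented : RD (CONS (unary 2) (v 0)) >pop S2 (RD (v 0))
  rd₂-oriented = pop-prec refl (prec< {rdS} {ŝ₂} ≤-refl) (λ { zero () }) (λ { zero _ → rd-recursion 2 })
                   (λ { zero zero _ _ _ _ → refl })

  oriented-machine : All Oriented machineRules
  oriented-machine =
    value-rhs _ ranked tt tt ∷                                                        --  0
    tl-oriented 1 (pop-sub (# 0) (inj₂ ≈refl)) ∷                                      --  1
    tl-oriented 2 (pop-sub (# 0) (inj₂ ≈refl)) ∷                                      --  2
    value-rhs _ ranked tt tt ∷ value-rhs _ ranked tt tt ∷ value-rhs _ ranked tt tt ∷   --  3–5
    find-oriented ∷ step-oriented ∷                                                   --  6, 7
    disp-act tt tt ∷ disp-act tt tt ∷ disp-act tt tt ∷ disp-act tt tt ∷               --  8–11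
    value-rhs _ ranked tt tt ∷ value-rhs _ ranked tt tt ∷                              -- 12, 13
    act-move refl (λ _ → refl) tt tt ∷ act-move refl (λ _ → refl) tt tt ∷              -- 14, 15
    value-rhs _ ranked tt tt ∷ value-rhs _ ranked tt tt ∷
    value-rhs _ ranked tt tt ∷ value-rhs _ ranked tt tt ∷                              -- 16–19
    out-oriented ∷                                                                     -- 20
    value-rhs _ ranked tt tt ∷ value-rhs _ ranked tt tt ∷                              -- 21, 22
    rd₁-oriented ∷ rd₂-oriented ∷                                                      -- 23, 24
    value-rhs _ ranked tt tt ∷ []                                                      -- 25
    where
      ranked : ∀ {m} → 1 ≤ suc m
      ranked = s≤s z≤n
      disp-act : ∀ {ss ts} → T (areValues? ts) → T (variableCondition? 10 (app dispS ss) (app actS ts)) →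
                 app dispS ss >pop app actS ts
      disp-act {ts = ts} = safe-values-rhs ts ≤-refl (λ _ → refl)
      act-move : ∀ {ss g ts} → rank g ≡ 1 → (∀ j → safeF g j ≡ true) → T (areValues? ts) →
                 T (variableCondition? 10 (app actS ss) (app g ts)) → app actS ss >pop app g ts
      act-move {ts = ts} rank-g all-safe = safe-values-rhs ts (≤-reflexive (cong suc rank-g)) all-safe

  iterStep-oriented : Oriented iterStep
  iterStep-oriented = pop-prec refl (prec< {itS (level 0)} {stepS} (s≤s (s≤s (s≤s (s≤s (s≤s z≤n))))))
    (λ { zero _ → sq-sub (# 2) (λ _ → refl) (inj₂ ≈refl) ; (suc zero) () })
    (λ { zero () ; (suc zero) _ → pop-sub (# 3) (inj₂ ≈refl) })
    (λ { zero _ () ; (suc zero) zero _ () ; (suc zero) (suc zero) _ _ _ _ → refl })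

  -- it_{k+1}(m, cons(x, ns), t, c) > it_k(m, m, t, it_{k+1}(m, ns, t, c)): the
  -- outer call has lower precedence; the inner call decreases ns.
  iterCons-oriented : ∀ k → suc k ≤ D → Oriented (iterCons k)
  iterCons-oriented k k<D = pop-prec refl (prec< {itS (level (suc k))} {itS (level k)} lower)
    (λ { zero _ → sq-sub (# 0) (λ _ → refl) (inj₂ ≈refl)
       ; (suc zero) _ → sq-sub (# 0) (λ _ → refl) (inj₂ ≈refl)
       ; (suc (suc zero)) _ → sq-sub (# 2) (λ _ → refl) (inj₂ ≈refl)
       ; (suc (suc (suc zero))) () })
    (λ { zero () ; (suc zero) () ; (suc (suc zero)) ()
       ; (suc (suc (suc zero))) _ → pop-eq refl (∼-refl {itS (level (suc k))}) shorter-list (mulGe-equal ≈refl) })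
    (λ { zero _ () ; (suc zero) _ () ; (suc (suc zero)) _ ()
       ; (suc (suc (suc zero))) zero _ () ; (suc (suc (suc zero))) (suc zero) _ ()
       ; (suc (suc (suc zero))) (suc (suc zero)) _ ()
       ; (suc (suc (suc zero))) (suc (suc (suc zero))) _ _ _ _ → refl })
    where
      lower : rank (itS (level k)) < rank (itS (level (suc k)))
      lower rewrite toℕ-level k (<⇒≤ k<D) | toℕ-level (suc k) k<D = ≤-refl
      shorter-list : MulGt _>pop_ _≈_ (v 0 ∷ CONS (v 1) (v 2) ∷ v 3 ∷ []) (v 0 ∷ v 2 ∷ v 3 ∷ [])
      shorter-list = v 0 ∷ v 3 ∷ [] , CONS (v 1) (v 2) ∷ [] , v 0 ∷ v 3 ∷ [] , v 2 ∷ [] ,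
                     Perm.prep (v 0) (Perm.swap _ _ Perm.refl) , Perm.prep (v 0) (Perm.swap _ _ Perm.refl) ,
                     (≈refl Pointwise.∷ ≈refl Pointwise.∷ Pointwise.[]) , (λ ()) ,
                     (here (pop-sub (# 1) (inj₂ ≈refl)) ∷ [])

  oriented-iter : ∀ k → k ≤ D → All Oriented (iterRules k)
  oriented-iter zero    _   = iterStep-oriented ∷ []
  oriented-iter (suc k) k<D = value-rhs _ (s≤s z≤n) tt tt ∷ iterCons-oriented k k<D ∷ oriented-iter k (<⇒≤ k<D)

  -- Every argument of the rhs of the rule for g is built below g from its
  -- (normal) arguments, so the rhs is >sq-smaller.
  tape-sq : ∀ {k} (ts : Vec Term k) → (∀ i → lhs mainRule >sq lookup ts i) → lhs mainRule >sq tlChain ts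
  tape-sq []       _       = sq-prec refl (prec< {gS} {nilS} (s≤s z≤n)) (λ ())
  tape-sq (t ∷ ts) smaller = sq-prec refl (prec< {gS} {tlS} (s≤s (s≤s z≤n)))
    (λ { zero → smaller zero ; (suc zero) → tape-sq ts (smaller ∘ suc) })

  main-oriented : Oriented mainRule
  main-oriented = pop-prec refl (prec< {gS} {outS} (s≤s (s≤s (s≤s z≤n)))) (λ { zero _ → iteration-sq })
                    (λ { zero () }) (λ { zero zero _ _ _ _ → refl })
    where
      tape = tlChain (vars 0 n)
      tape-smaller : lhs mainRule >sq tape
      tape-smaller = tape-sq (vars 0 n) (λ i → sq-sub i (λ _ → refl) (inj₂ ≈refl))
      loop-list-smaller : lhs mainRule >sq CONS E (CONS E tape)
      loop-list-smaller = sq-prec refl (prec< {gS} {consS} (s≤s z≤n))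
        (λ { zero       → ground-sq (s≤s z≤n) (ground-unary 0)
           ; (suc zero) → sq-prec refl (prec< {gS} {consS} (s≤s z≤n))
                            (λ { zero → ground-sq (s≤s z≤n) (ground-unary 0) ; (suc zero) → tape-smaller }) })
      lower : rank (itS (level D)) < rank gS
      lower rewrite toℕ-level D ≤-refl = ≤-refl
      iteration-sq : lhs mainRule >sq IT (level D) (CONS E (CONS E tape)) (CONS E (CONS E tape)) TBL (MK QS tape)
      iteration-sq = sq-prec refl (prec< {gS} {itS (level D)} lower)
        (λ { zero → loop-list-smaller ; (suc zero) → loop-list-smaller
           ; (suc (suc zero)) → ground-sq (s≤s z≤n) (ground-table Q 0)
           ; (suc (suc (suc zero))) → sq-prec refl (prec< {gS} {mkS} (s≤s (s≤s z≤n)))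
               (λ { zero → ground-sq (s≤s z≤n) (ground-unary (toℕ start)) ; (suc zero) → tape-smaller }) })

  predicative-recursive : PredicativeRecursive R
  predicative-recursive = constructor-TRS , safeF , _≿_ , safe-con , admissible , LAll.lookup oriented
    where
      oriented : All Oriented R
      oriented = LAllP.++⁺ (oriented-iter D ≤-refl) (main-oriented ∷ oriented-machine)

-- Theorem 6.5.  Simulate the polynomial-time machine with D = c+d loop levels:
-- its halting time is at most c·(s+1)^d ≤ (s+2)^D, the number of steps the
-- simulation performs, and running beyond the halting time changes nothing.
theorem6p5 : ∀ {n} (f : Vec W n → W) → FP f →
    Σ Signature λ sig → Σ (Sig.TRS sig) λ R →
    Sig.WellFormed sig R × Sig.ConstructorTRS sig R × Sig.Orthogonal sig R ×
    Sig.PredicativeRecursive sig R × Sig.Computes sig R f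
theorem6p5 {n} f (M , c , d , in-time) =
  sig , R , well-formed , constructor-TRS , (left-linear , non-overlapping-R) ,
  predicative-recursive , computes f simulation-outputs-f
  where
    open Simulation n (c + d) M
    open Runs M using (run-beyond-halting)

    simulation-outputs-f : ∀ vs → output (run M (loopLength vs ^ (c + d)) (initConfig M (inputSyms vs))) ≡ f vs
    simulation-outputs-f vs with in-time vs
    ... | t , t≤bound , halted , output≡f = begin
      output (run M (loopLength vs ^ (c + d)) start)   ≡⟨ cong output (run-beyond-halting t _ start enough-steps halted) ⟩
      output (run M t start)                          ≡⟨ output≡f ⟩
      f vs                                            ∎
      where
        open ≡-Reasoning
        start = initConfig M (inputSyms vs)
        enough-steps = ≤-trans t≤bound (polynomial≤power c d (inputSize vs))
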